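{- Let $A$ be a c.e. set. (i) $A$ is $\mathcal{D}$-maximal and of Type 4 if and only if $A$ is Herrmann. (ii) $A$ is $\mathcal{D}$-maximal and of Type 5 if and only if $A$ is hemi-Herrmann.
   Context: All sets are c.e. subsets of $\omega$. $X\subseteq^*Y$ means $X-Y$ finite, $X=^*Y$ means both inclusions mod finite. A coinfinite c.e. set $A$ is $\mathcal{D}$-maximal if for every c.e. $W$ there is a c.e. $D$ disjoint from $A$ with $W\subseteq^*A\sqcup D$ or $W\cup(A\sqcup D)=^*\omega$. $A$ is strongly $r$-separable if for every c.e. $B$ disjoint from $A$ there is a computable $C$ with $B\subseteq C$, $A\subseteq\overline{C}$, and $C-B$ infinite. $A$ is Herrmann if it is $\mathcal{D}$-maximal and strongly $r$-separable; a noncomputable c.e. $A$ is hemi-Herrmann if there is a noncomputable c.e. $B$ disjoint from $A$ with $A\sqcup B$ Herrmann. A collection $\mathcal{G}$ of c.e. sets generates $\mathcal{D}(A)$ if every member is disjoint from $A$ and every c.e. set disjoint from $A$ is $\subseteq^*$ a finite union of members. Types of generating collections: Type 1: $\{\emptyset\}$. Type 2: $\{R\}$, $R$ infinite computable. Type 3: $\{W\}$, $W$ infinite noncomputable. Type 4: $\{R_0,R_1,\dots\}$ infinite pairwise disjoint computable. Type 5: $\{D_0,R_0,R_1,\dots\}$ all infinite pairwise disjoint, $D_0$ the only noncomputable one. $A$ is Type $n$ if $\mathcal{D}(A)$ has a generating collection of Type $n$ but none of Type $m$ for $m<n$. -}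

module Defs where

open import Data.Nat using (ℕ; zero; suc; _<_; _≤_)
open import Data.Fin using (Fin)
open import Data.Vec using (Vec; []; _∷_; lookup)
open import Data.List using (List)
open import Data.List.Relation.Unary.Any using (Any)
open import Data.Product using (Σ; _×_; _,_)
open import Data.Sum using (_⊎_)
open import Data.Unit using (⊤)
open import Data.Empty using (⊥)
open import Data.Maybe using (Maybe; just; nothing)
open import Relation.Nullary using (¬_)
open import Relation.Binary.PropositionalEquality using (_≡_)
open import Function.Bundles using (_⇔_)

data Code : ℕ → Set where
  zr   : ∀ {k} → Code k
  sc   : Code 1
  proj : ∀ {k} → Fin k → Code k
  comp : ∀ {k m} → Code m → Vec (Code k) m → Code k
  prec : ∀ {k} → Code k → Code (suc (suc k)) → Code (suc k)
  mu   : ∀ {k} → Code (suc k) → Code k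

mutual
  data Eval : ∀ {k} → Code k → Vec ℕ k → ℕ → Set where
    ev-zr   : ∀ {k} {xs : Vec ℕ k} → Eval zr xs 0
    ev-sc   : ∀ {x} → Eval sc (x ∷ []) (suc x)
    ev-proj : ∀ {k} {i : Fin k} {xs} → Eval (proj i) xs (lookup xs i)
    ev-comp : ∀ {k m} {f : Code m} {gs : Vec (Code k) m} {xs ys y} →
              EvalAll gs xs ys → Eval f ys y → Eval (comp f gs) xs y
    ev-prec0 : ∀ {k} {f : Code k} {g xs y} →
               Eval f xs y → Eval (prec f g) (0 ∷ xs) y
    ev-precS : ∀ {k} {f : Code k} {g xs n r y} →
               Eval (prec f g) (n ∷ xs) r → Eval g (n ∷ r ∷ xs) y →
               Eval (prec f g) (suc n ∷ xs) y
    ev-mu   : ∀ {k} {f : Code (suc k)} {xs y} →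
              Eval f (y ∷ xs) 0 →
              (∀ z → z < y → Σ ℕ λ v → Eval f (z ∷ xs) (suc v)) →
              Eval (mu f) xs y

  data EvalAll : ∀ {k m} → Vec (Code k) m → Vec ℕ k → Vec ℕ m → Set where
    []  : ∀ {k} {xs : Vec ℕ k} → EvalAll [] xs []
    _∷_ : ∀ {k m} {g : Code k} {gs : Vec (Code k) m} {xs y ys} →
          Eval g xs y → EvalAll gs xs ys → EvalAll (g ∷ gs) xs (y ∷ ys)

Pred : Set₁
Pred = ℕ → Set

W : Code 1 → Pred
W e x = Σ ℕ λ y → Eval e (x ∷ []) y

∅ : Pred
∅ _ = ⊥

_∪_ : Pred → Pred → Pred
(X ∪ Y) x = X x ⊎ Y x

Disjoint : Pred → Pred → Set
Disjoint X Y = ∀ x → X x → Y x → ⊥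

Finite : Pred → Set
Finite X = Σ ℕ λ n → ∀ x → X x → x < n

Infinite : Pred → Set
Infinite X = ∀ n → Σ ℕ λ x → n ≤ x × X x

Coinfinite : Pred → Set
Coinfinite X = Infinite (λ x → ¬ X x)

Cofinite : Pred → Set
Cofinite X = Σ ℕ λ n → ∀ x → n ≤ x → X x

_⊆*_ : Pred → Pred → Set
X ⊆* Y = Finite (λ x → X x × ¬ Y x)

Computable : Pred → Set
Computable X = Σ (Code 1) λ r →
  ∀ x → (X x × Eval r (x ∷ []) 1) ⊎ (¬ X x × Eval r (x ∷ []) 0)

DMaximal : Pred → Set
DMaximal A = Coinfinite A ×
  (∀ (V : Code 1) → Σ (Code 1) λ D → Disjoint (W D) A ×
     ((W V ⊆* (A ∪ W D)) ⊎ Cofinite (W V ∪ (A ∪ W D))))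

StronglyRSeparable : Pred → Set
StronglyRSeparable A = ∀ (B : Code 1) → Disjoint (W B) A →
  Σ (Code 1) λ C → Computable (W C) ×
    (∀ x → W B x → W C x) × (∀ x → A x → ¬ W C x) ×
    Infinite (λ x → W C x × ¬ W B x)

Herrmann : Pred → Set
Herrmann A = DMaximal A × StronglyRSeparable A

HemiHerrmann : Pred → Set
HemiHerrmann A = ¬ Computable A ×
  Σ (Code 1) λ B → ¬ Computable (W B) × Disjoint (W B) A × Herrmann (A ∪ W B)

-- Generating collections of D(A), given as an indexed family.

⋃ : {I : Set} → (I → Pred) → List I → Pred
⋃ G is x = Any (λ i → G i x) is

Generates : Pred → {I : Set} → (I → Pred) → Set
Generates A {I} G = (∀ i → Disjoint (G i) A) ×
  (∀ (V : Code 1) → Disjoint (W V) A → Σ (List I) λ is → W V ⊆* ⋃ G is)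

HasType1 : Pred → Set
HasType1 A = Generates A {⊤} (λ _ → ∅)

HasType2 : Pred → Set
HasType2 A = Σ (Code 1) λ R → Infinite (W R) × Computable (W R) ×
  Generates A {⊤} (λ _ → W R)

HasType3 : Pred → Set
HasType3 A = Σ (Code 1) λ V → Infinite (W V) × ¬ Computable (W V) ×
  Generates A {⊤} (λ _ → W V)

HasType4 : Pred → Set
HasType4 A = Σ (ℕ → Code 1) λ R →
  (∀ i → Infinite (W (R i)) × Computable (W (R i))) ×
  (∀ i j → ¬ i ≡ j → Disjoint (W (R i)) (W (R j))) ×
  Generates A {ℕ} (λ i → W (R i))

HasType5 : Pred → Set
HasType5 A = Σ (Code 1) λ D₀ → Σ (ℕ → Code 1) λ R →
  let G : Maybe ℕ → Pred
      G = λ { nothing → W D₀ ; (just i) → W (R i) } in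
  (∀ i → Infinite (G i)) ×
  (∀ i j → ¬ i ≡ j → Disjoint (G i) (G j)) ×
  ¬ Computable (W D₀) × (∀ i → Computable (W (R i))) ×
  Generates A {Maybe ℕ} G

IsType4 : Pred → Set
IsType4 A = HasType4 A × ¬ HasType1 A × ¬ HasType2 A × ¬ HasType3 A

IsType5 : Pred → Set
IsType5 A = HasType5 A × ¬ HasType1 A × ¬ HasType2 A × ¬ HasType3 A × ¬ HasType4 A

module Submission where

-- The heart of the argument is a correspondence between strong
-- r-separability of a set H and "exhausting blocks": a sequence R of
-- infinite, computable, pairwise disjoint sets disjoint from H such that
-- every c.e. set disjoint from H is almost contained in finitely many of them.
--   * Blocks separate: a c.e. B almost inside finitely many blocks is strongly
--     separated from H by those blocks plus one fresh block.
--   * Separability yields blocks: enumerate the c.e. sets Vₙ disjoint from H,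
--     let S (n+1) strongly separate Sₙ ∪ Vₙ from H, and take S (n+1) − Sₙ.
-- Part (i) follows directly (a strongly r-separable set has no generating
-- collection consisting of a single set).  Part (ii) transports this between
-- A and A ∪ D₀ (forward) and A ∪ B (backward); the lower types are excluded
-- because each would make A or B computable.

open import Defs
open import Level using (0ℓ)
open import Axiom.ExcludedMiddle using (ExcludedMiddle)
open import Data.Nat using (ℕ; zero; suc; _+_; _*_; _∸_; _<_; _≤_; z≤n; s≤s; _≟_; _⊔_; _<?_)
open import Data.Nat.Properties
open import Data.Nat.ListAction using (sum)
open import Data.Fin using (Fin; toℕ) renaming (zero to fz; suc to fs)
open import Data.Vec using (Vec; []; _∷_; lookup; map; tabulate)
open import Data.Vec.Properties using (tabulate∘lookup)
open import Data.List using (List; []; _∷_)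
import Data.List as List
open import Data.List.Relation.Unary.Any using (Any; here; there)
open import Data.Maybe using (Maybe; just; nothing)
open import Data.Maybe.Properties using (just-injective)
open import Data.Product using (Σ; _×_; _,_; proj₁; proj₂)
open import Data.Sum using (_⊎_; inj₁; inj₂)
open import Data.Empty using (⊥; ⊥-elim)
open import Data.Unit using (⊤; tt)
open import Relation.Nullary using (¬_; yes; no; Dec)
open import Relation.Binary.Definitions using (tri<; tri≈; tri>)
open import Relation.Binary.PropositionalEquality using (_≡_; refl; sym; trans; cong; cong₂; subst)
open import Function.Bundles using (_⇔_; mk⇔)

mutual
  eval-det : ∀ {k} {c : Code k} {xs y y'} → Eval c xs y → Eval c xs y' → y ≡ y'
  eval-det ev-zr ev-zr = refl
  eval-det ev-sc ev-sc = refl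
  eval-det ev-proj ev-proj = refl
  eval-det (ev-comp as b) (ev-comp as' b') with evalAll-det as as'
  ... | refl = eval-det b b'
  eval-det (ev-prec0 a) (ev-prec0 a') = eval-det a a'
  eval-det (ev-precS a b) (ev-precS a' b') with eval-det a a'
  ... | refl = eval-det b b'
  -- two minimisation witnesses: the smaller one would make the other search stop
  eval-det {y = y} {y'} (ev-mu a below) (ev-mu a' below') with <-cmp y y'
  ... | tri≈ _ y≡y' _ = y≡y'
  ... | tri< y<y' _ _ with eval-det a (proj₂ (below' y y<y'))
  ... | ()
  eval-det {y = y} {y'} (ev-mu a below) (ev-mu a' below') | tri> _ _ y'<y
    with eval-det a' (proj₂ (below y' y'<y))
  ... | ()

  evalAll-det : ∀ {k m} {gs : Vec (Code k) m} {xs ys ys'} →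
    EvalAll gs xs ys → EvalAll gs xs ys' → ys ≡ ys'
  evalAll-det [] [] = refl
  evalAll-det (a ∷ as) (b ∷ bs) = cong₂ _∷_ (eval-det a b) (evalAll-det as bs)

Computes : ∀ {k} → Code k → (Vec ℕ k → ℕ) → Set
Computes c F = ∀ xs → Eval c xs (F xs)

ComputesAll : ∀ {k m} → Vec (Code k) m → (Vec ℕ k → Vec ℕ m) → Set
ComputesAll gs F = ∀ xs → EvalAll gs xs (F xs)

computes-ext : ∀ {k} {c : Code k} {F G} → (∀ xs → F xs ≡ G xs) → Computes c F → Computes c G
computes-ext F≗G c xs = subst (Eval _ xs) (F≗G xs) (c xs)

computes-zr : ∀ {k} → Computes {k} zr (λ _ → 0)
computes-zr xs = ev-zr

computes-proj : ∀ {k} (i : Fin k) → Computes (proj i) (λ xs → lookup xs i)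
computes-proj i xs = ev-proj

computes-comp : ∀ {k m} {f : Code m} {gs : Vec (Code k) m} {F G} →
  Computes f F → ComputesAll gs G → Computes (comp f gs) (λ xs → F (G xs))
computes-comp f gs xs = ev-comp (gs xs) (f _)

computes-sc : Computes sc (λ { (x ∷ []) → suc x })
computes-sc (x ∷ []) = ev-sc

computes-[] : ∀ {k} → ComputesAll {k} [] (λ _ → [])
computes-[] xs = []

computes-∷ : ∀ {k m} {g : Code k} {gs : Vec (Code k) m} {F G} →
  Computes g F → ComputesAll gs G → ComputesAll (g ∷ gs) (λ xs → F xs ∷ G xs)
computes-∷ g gs xs = g xs ∷ gs xs

primRec : ∀ {k} → (Vec ℕ k → ℕ) → (Vec ℕ (suc (suc k)) → ℕ) → ℕ → Vec ℕ k → ℕ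
primRec F G zero xs = F xs
primRec F G (suc n) xs = G (n ∷ primRec F G n xs ∷ xs)

computes-prec : ∀ {k} {f : Code k} {g F G} → Computes f F → Computes g G →
  ∀ n xs → Eval (prec f g) (n ∷ xs) (primRec F G n xs)
computes-prec f g zero xs = ev-prec0 (f xs)
computes-prec f g (suc n) xs = ev-precS (computes-prec f g n xs) (g _)

ap1 : ∀ {k} → Code 1 → Code k → Code k
ap1 f a = comp f (a ∷ [])

ap2 : ∀ {k} → Code 2 → Code k → Code k → Code k
ap2 f a b = comp f (a ∷ b ∷ [])

ap3 : ∀ {k} → Code 3 → Code k → Code k → Code k → Code k
ap3 f a b c = comp f (a ∷ b ∷ c ∷ [])

computes-ap1 : ∀ {k} {f : Code 1} {a : Code k} {F A} →
  Computes f F → Computes a A → Computes (ap1 f a) (λ xs → F (A xs ∷ []))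
computes-ap1 f a = computes-comp f (computes-∷ a computes-[])

computes-ap2 : ∀ {k} {f : Code 2} {a b : Code k} {F A B} →
  Computes f F → Computes a A → Computes b B → Computes (ap2 f a b) (λ xs → F (A xs ∷ B xs ∷ []))
computes-ap2 f a b = computes-comp f (computes-∷ a (computes-∷ b computes-[]))

computes-ap3 : ∀ {k} {f : Code 3} {a b c : Code k} {F A B C} →
  Computes f F → Computes a A → Computes b B → Computes c C →
  Computes (ap3 f a b c) (λ xs → F (A xs ∷ B xs ∷ C xs ∷ []))
computes-ap3 f a b c = computes-comp f (computes-∷ a (computes-∷ b (computes-∷ c computes-[])))

x0 : ∀ {k} → Code (suc k)
x0 = proj fz

x1 : ∀ {k} → Code (suc (suc k))
x1 = proj (fs fz)

x2 : ∀ {k} → Code (suc (suc (suc k)))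
x2 = proj (fs (fs fz))

const : ∀ {k} → ℕ → Code k
const zero = zr
const (suc n) = ap1 sc (const n)

computes-const : ∀ {k} n → Computes {k} (const n) (λ _ → n)
computes-const zero = computes-zr
computes-const (suc n) xs = ev-comp (computes-const n xs ∷ []) ev-sc

addC : Code 2
addC = prec x0 (ap1 sc x1)

computes-add : Computes addC (λ { (a ∷ b ∷ []) → a + b })
computes-add (a ∷ b ∷ []) =
  subst (Eval addC (a ∷ b ∷ [])) (unfold a)
        (computes-prec (computes-proj fz) (computes-ap1 computes-sc (computes-proj (fs fz))) a (b ∷ []))
  where
  unfold : ∀ a → primRec (λ xs → lookup xs fz) (λ xs → suc (lookup xs (fs fz))) a (b ∷ []) ≡ a + b
  unfold zero = refl
  unfold (suc a) = cong suc (unfold a)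

mulC : Code 2
mulC = prec zr (ap2 addC x2 x1)

computes-mul : Computes mulC (λ { (a ∷ b ∷ []) → a * b })
computes-mul (a ∷ b ∷ []) =
  subst (Eval mulC (a ∷ b ∷ [])) (unfold a)
        (computes-prec computes-zr (computes-ap2 computes-add (computes-proj (fs (fs fz))) (computes-proj (fs fz))) a (b ∷ []))
  where
  unfold : ∀ a → primRec (λ _ → 0) (λ xs → lookup xs (fs (fs fz)) + lookup xs (fs fz)) a (b ∷ []) ≡ a * b
  unfold zero = refl
  unfold (suc a) = cong (b +_) (unfold a)

predC : Code 1
predC = prec zr x0

computes-pred : Computes predC (λ { (a ∷ []) → a ∸ 1 })
computes-pred (zero ∷ []) = ev-prec0 ev-zr
computes-pred (suc a ∷ []) = ev-precS (computes-prec computes-zr (computes-proj fz) a []) ev-proj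

monusC : Code 2
monusC = prec x0 (ap1 predC x1)

computes-monus : Computes monusC (λ { (n ∷ x ∷ []) → x ∸ n })
computes-monus (n ∷ x ∷ []) =
  subst (Eval monusC (n ∷ x ∷ [])) (unfold n)
        (computes-prec (computes-proj fz) (computes-ap1 computes-pred (computes-proj (fs fz))) n (x ∷ []))
  where
  unfold : ∀ n → primRec (λ xs → lookup xs fz) (λ xs → lookup xs (fs fz) ∸ 1) n (x ∷ []) ≡ x ∸ n
  unfold zero = refl
  unfold (suc n) = trans (cong (_∸ 1) (unfold n)) (trans (∸-+-assoc x n 1) (cong (x ∸_) (+-comm n 1)))

sg : ℕ → ℕ
sg zero = 0
sg (suc _) = 1

nsg : ℕ → ℕ
nsg zero = 1
nsg (suc _) = 0

sgC : Code 1
sgC = prec zr (const 1)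

computes-sg : Computes sgC (λ { (a ∷ []) → sg a })
computes-sg (zero ∷ []) = ev-prec0 ev-zr
computes-sg (suc a ∷ []) = ev-precS (computes-prec computes-zr (computes-const 1) a []) (computes-const 1 _)

nsgC : Code 1
nsgC = prec (const 1) zr

computes-nsg : Computes nsgC (λ { (a ∷ []) → nsg a })
computes-nsg (zero ∷ []) = ev-prec0 (computes-const 1 [])
computes-nsg (suc a ∷ []) = ev-precS (computes-prec (computes-const 1) computes-zr a []) ev-zr

eqf : ℕ → ℕ → ℕ
eqf a b = nsg ((a ∸ b) + (b ∸ a))

eqf-refl : ∀ a → eqf a a ≡ 1
eqf-refl a rewrite n∸n≡0 a = refl

eqf-≢ : ∀ a b → ¬ a ≡ b → eqf a b ≡ 0
eqf-≢ a b a≢b with a ∸ b | b ∸ a | m∸n≡0⇒m≤n {a} {b} | m∸n≡0⇒m≤n {b} {a}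
... | zero | zero | a≤b | b≤a = ⊥-elim (a≢b (≤-antisym (a≤b refl) (b≤a refl)))
... | zero | suc _ | _ | _ = refl
... | suc _ | _ | _ | _ = refl

eqC : Code 2
eqC = ap1 nsgC (ap2 addC (ap2 monusC x1 x0) (ap2 monusC x0 x1))

computes-eq : Computes eqC (λ { (a ∷ b ∷ []) → eqf a b })
computes-eq = computes-ext (λ { (a ∷ b ∷ []) → refl })
  (computes-ap1 computes-nsg (computes-ap2 computes-add
    (computes-ap2 computes-monus (computes-proj (fs fz)) (computes-proj fz))
    (computes-ap2 computes-monus (computes-proj fz) (computes-proj (fs fz)))))

gd : ℕ → ℕ → ℕ
gd zero b = 0
gd (suc _) b = b

gdC : Code 2
gdC = ap2 mulC (ap1 sgC x0) x1

computes-gd : Computes gdC (λ { (a ∷ b ∷ []) → gd a b })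
computes-gd = computes-ext (λ { (zero ∷ b ∷ []) → refl ; (suc a ∷ b ∷ []) → +-identityʳ b })
  (computes-ap2 computes-mul (computes-ap1 computes-sg (computes-proj fz)) (computes-proj (fs fz)))

cond : ℕ → ℕ → ℕ → ℕ
cond zero a b = b
cond (suc _) a b = a

condC : Code 3
condC = ap2 addC (ap2 mulC (ap1 sgC x0) x1) (ap2 mulC (ap1 nsgC x0) x2)

computes-cond : Computes condC (λ { (c ∷ a ∷ b ∷ []) → cond c a b })
computes-cond = computes-ext
  (λ { (zero ∷ a ∷ b ∷ []) → +-identityʳ b
     ; (suc c ∷ a ∷ b ∷ []) → trans (+-identityʳ (a + 0)) (+-identityʳ a) })
  (computes-ap2 computes-add
    (computes-ap2 computes-mul (computes-ap1 computes-sg (computes-proj fz)) (computes-proj (fs fz)))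
    (computes-ap2 computes-mul (computes-ap1 computes-nsg (computes-proj fz)) (computes-proj (fs (fs fz)))))

IsChar : Pred → (ℕ → ℕ) → Set
IsChar P f = ∀ x → (P x × f x ≡ 1) ⊎ (¬ P x × f x ≡ 0)

computable-by : ∀ {P} {r : Code 1} {F} → Computes r F → IsChar P (λ x → F (x ∷ [])) → Computable P
computable-by {r = r} {F} r-computes isChar = r , λ x → evaluate x (isChar x)
  where
  evaluate : ∀ x → _ → _
  evaluate x (inj₁ (p , e)) = inj₁ (p , subst (Eval r (x ∷ [])) e (r-computes (x ∷ [])))
  evaluate x (inj₂ (p , e)) = inj₂ (p , subst (Eval r (x ∷ [])) e (r-computes (x ∷ [])))

charFun : ∀ {P} → Computable P → ℕ → ℕ
charFun (r , decide) x with decide x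
... | inj₁ _ = 1
... | inj₂ _ = 0

charFun-computes : ∀ {P} (c : Computable P) → Computes (proj₁ c) (λ { (x ∷ []) → charFun c x })
charFun-computes (r , decide) (x ∷ []) with decide x
... | inj₁ (_ , ev) = ev
... | inj₂ (_ , ev) = ev

charFun-isChar : ∀ {P} (c : Computable P) → IsChar P (charFun c)
charFun-isChar (r , decide) x with decide x
... | inj₁ (p , _) = inj₁ (p , refl)
... | inj₂ (p , _) = inj₂ (p , refl)

computable-ext : ∀ {P Q} → (∀ x → P x → Q x) → (∀ x → Q x → P x) → Computable P → Computable Q
computable-ext P⊆Q Q⊆P (r , decide) = r , λ x → transport x (decide x)
  where
  transport : ∀ x → _ → _
  transport x (inj₁ (p , e)) = inj₁ (P⊆Q x p , e)
  transport x (inj₂ (p , e)) = inj₂ ((λ q → p (Q⊆P x q)) , e)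

computable-∪ : ∀ {P Q} → Computable P → Computable Q → Computable (P ∪ Q)
computable-∪ cP cQ = computable-by
  (computes-ap1 computes-sg (computes-ap2 computes-add
    (computes-ap1 (charFun-computes cP) (computes-proj fz))
    (computes-ap1 (charFun-computes cQ) (computes-proj fz))))
  isChar
  where
  isChar : IsChar _ _
  isChar x with charFun-isChar cP x | charFun-isChar cQ x
  ... | inj₁ (p , e) | _ = inj₁ (inj₁ p , cong (λ a → sg (a + charFun cQ x)) e)
  ... | inj₂ (p , e) | inj₁ (q , e') = inj₁ (inj₂ q , cong₂ (λ a b → sg (a + b)) e e')
  ... | inj₂ (p , e) | inj₂ (q , e') =
    inj₂ ((λ { (inj₁ a) → p a ; (inj₂ b) → q b }) , cong₂ (λ a b → sg (a + b)) e e')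

computable-∩ : ∀ {P Q} → Computable P → Computable Q → Computable (λ x → P x × Q x)
computable-∩ cP cQ = computable-by
  (computes-ap2 computes-mul
    (computes-ap1 (charFun-computes cP) (computes-proj fz))
    (computes-ap1 (charFun-computes cQ) (computes-proj fz)))
  isChar
  where
  isChar : IsChar _ _
  isChar x with charFun-isChar cP x | charFun-isChar cQ x
  ... | inj₁ (p , e) | inj₁ (q , e') = inj₁ ((p , q) , cong₂ _*_ e e')
  ... | inj₁ (p , e) | inj₂ (q , e') = inj₂ ((λ pq → q (proj₂ pq)) , cong₂ _*_ e e')
  ... | inj₂ (p , e) | _ = inj₂ ((λ pq → p (proj₁ pq)) , cong (_* charFun cQ x) e)

computable-¬ : ∀ {P} → Computable P → Computable (λ x → ¬ P x)
computable-¬ cP = computable-by (computes-ap1 computes-nsg (computes-ap1 (charFun-computes cP) (computes-proj fz))) isChar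
  where
  isChar : IsChar _ _
  isChar x with charFun-isChar cP x
  ... | inj₁ (p , e) = inj₂ ((λ ¬p → ¬p p) , cong nsg e)
  ... | inj₂ (p , e) = inj₁ (p , cong nsg e)

computable-∅ : Computable ∅
computable-∅ = computable-by {r = zr} computes-zr (λ x → inj₂ ((λ ()) , refl))

computable-singleton : ∀ n → Computable (λ x → x ≡ n)
computable-singleton n = computable-by (computes-ap2 computes-eq (computes-proj fz) (computes-const n)) isChar
  where
  isChar : IsChar _ _
  isChar x with x ≟ n
  ... | yes refl = inj₁ (refl , eqf-refl x)
  ... | no x≢n = inj₂ (x≢n , eqf-≢ x n x≢n)

-- The part of a pointwise decidable set below a bound is computable
-- (a finite union of singletons); the decision procedure itself need not be computable.
computable-bounded : (P : Pred) → (∀ x → Dec (P x)) → ∀ n → Computable (λ x → x < n × P x)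
computable-bounded P P? zero = computable-ext (λ x ()) (λ x ()) computable-∅
computable-bounded P P? (suc n) with P? n
... | yes pn = computable-ext grow shrink (computable-∪ (computable-bounded P P? n) (computable-singleton n))
  where
  grow : ∀ x → (x < n × P x) ⊎ x ≡ n → x < suc n × P x
  grow x (inj₁ (x<n , p)) = m<n⇒m<1+n x<n , p
  grow x (inj₂ refl) = ≤-refl , pn
  shrink : ∀ x → x < suc n × P x → (x < n × P x) ⊎ x ≡ n
  shrink x (x<1+n , p) with m<1+n⇒m<n∨m≡n x<1+n
  ... | inj₁ x<n = inj₁ (x<n , p)
  ... | inj₂ x≡n = inj₂ x≡n
... | no ¬pn = computable-ext grow shrink (computable-bounded P P? n)
  where
  grow : ∀ x → x < n × P x → x < suc n × P x
  grow x (x<n , p) = m<n⇒m<1+n x<n , p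
  shrink : ∀ x → x < suc n × P x → x < n × P x
  shrink x (x<1+n , p) with m<1+n⇒m<n∨m≡n x<1+n
  ... | inj₁ x<n = x<n , p
  ... | inj₂ refl = ⊥-elim (¬pn p)

computable-below : ∀ n → Computable (λ x → x < n)
computable-below n = computable-ext (λ x → proj₁) (λ x x<n → x<n , tt) (computable-bounded (λ _ → ⊤) (λ _ → yes tt) n)

record CodeFor (P : Pred) : Set where
  field
    code     : Code 1
    dom⊆     : ∀ x → W code x → P x
    dom⊇     : ∀ x → P x → W code x
open CodeFor

-- Every computable set is c.e.: search for an argument y at which
-- `nsg (χ x)` vanishes; this succeeds (with y = 0) exactly when χ x = 1.
ceCode : ∀ {P} → Computable P → CodeFor P
ceCode {P} cP = record { code = mu haltTest ; dom⊆ = dom⊆P ; dom⊇ = P⊆dom }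
  where
  haltTest : Code 2
  haltTest = ap1 nsgC (ap1 (proj₁ cP) x1)
  computes-haltTest : Computes haltTest (λ { (y ∷ x ∷ []) → nsg (charFun cP x) })
  computes-haltTest = computes-ext (λ { (y ∷ x ∷ []) → refl })
    (computes-ap1 computes-nsg (computes-ap1 (charFun-computes cP) (computes-proj (fs fz))))
  dom⊆P : ∀ x → W (mu haltTest) x → P x
  dom⊆P x (y , ev-mu stops _) with charFun-isChar cP x | eval-det stops (computes-haltTest (y ∷ x ∷ []))
  ... | inj₁ (p , _) | _ = p
  ... | inj₂ (_ , χ≡0) | stops≡ rewrite χ≡0 with stops≡
  ... | ()
  P⊆dom : ∀ x → P x → W (mu haltTest) x
  P⊆dom x p with charFun-isChar cP x | computes-haltTest (0 ∷ x ∷ [])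
  ... | inj₁ (_ , χ≡1) | ev rewrite χ≡1 = 0 , ev-mu ev (λ z ())
  ... | inj₂ (¬p , _) | _ = ⊥-elim (¬p p)

computable-dom : ∀ {P} (c : CodeFor P) → Computable P → Computable (W (code c))
computable-dom c = computable-ext (dom⊇ c) (dom⊆ c)

∅code : CodeFor ∅
∅code = ceCode computable-∅

-- Step-bounded evaluation.  `run e t xs` is 0 if the computation of e on xs
-- has not produced a value with budget t, and suc y if it has produced y.
-- A minimisation with budget t inspects the candidates 0 .. t-1; its search
-- state `search` is 1 while searching, suc (suc y) once y is found and 0 if
-- some candidate had no value yet.

guardAll : ∀ {m} → Vec ℕ m → ℕ → ℕ
guardAll [] b = b
guardAll (v ∷ vs) b = gd v (guardAll vs b)

predAll : ∀ {m} → Vec ℕ m → Vec ℕ m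
predAll = map (_∸ 1)

searchStep : ℕ → ℕ → ℕ → ℕ
searchStep s v k = cond (eqf s 1) (gd v (cond (eqf v 1) (suc (suc k)) 1)) s

mutual
  run : ∀ {k} → Code k → ℕ → Vec ℕ k → ℕ
  run zr t xs = 1
  run sc t (x ∷ []) = suc (suc x)
  run (proj i) t xs = suc (lookup xs i)
  run (comp f gs) t xs = guardAll (runAll gs t xs) (run f t (predAll (runAll gs t xs)))
  run (prec f g) t (n ∷ xs) = runPrec f g t n xs
  run (mu f) t xs = search f t xs t ∸ 1

  runAll : ∀ {k m} → Vec (Code k) m → ℕ → Vec ℕ k → Vec ℕ m
  runAll [] t xs = []
  runAll (g ∷ gs) t xs = run g t xs ∷ runAll gs t xs

  runPrec : ∀ {k} → Code k → Code (suc (suc k)) → ℕ → ℕ → Vec ℕ k → ℕ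
  runPrec f g t zero xs = run f t xs
  runPrec f g t (suc n) xs = gd (runPrec f g t n xs) (run g t (n ∷ (runPrec f g t n xs ∸ 1) ∷ xs))

  search : ∀ {k} → Code (suc k) → ℕ → Vec ℕ k → ℕ → ℕ
  search f t xs zero = 1
  search f t xs (suc j) = searchStep (search f t xs j) (run f t (j ∷ xs)) j

PositiveAt : ∀ {k} → Code (suc k) → ℕ → Vec ℕ k → ℕ → Set
PositiveAt f t xs z = Σ ℕ λ v → run f t (z ∷ xs) ≡ suc (suc v)

search-going : ∀ {k} (f : Code (suc k)) t xs j → search f t xs j ≡ 1 → ∀ z → z < j → PositiveAt f t xs z
search-going f t xs (suc j) e z z<1+j with search f t xs j in e1 | run f t (j ∷ xs) in e2
search-going f t xs (suc j) () z z<1+j | zero | _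
search-going f t xs (suc j) () z z<1+j | suc zero | zero
search-going f t xs (suc j) () z z<1+j | suc zero | suc zero
search-going f t xs (suc j) e z z<1+j | suc zero | suc (suc w) with m<1+n⇒m<n∨m≡n z<1+j
... | inj₁ z<j = search-going f t xs j e1 z z<j
... | inj₂ refl = w , e2
search-going f t xs (suc j) () z z<1+j | suc (suc y') | _

search-found : ∀ {k} (f : Code (suc k)) t xs j y → search f t xs j ≡ suc (suc y) →
  run f t (y ∷ xs) ≡ 1 × (∀ z → z < y → PositiveAt f t xs z)
search-found f t xs zero y ()
search-found f t xs (suc j) y e with search f t xs j in e1 | run f t (j ∷ xs) in e2
search-found f t xs (suc j) y () | zero | _
search-found f t xs (suc j) y () | suc zero | zero
search-found f t xs (suc j) .j refl | suc zero | suc zero = e2 , search-going f t xs j e1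
search-found f t xs (suc j) y () | suc zero | suc (suc w)
search-found f t xs (suc j) y refl | suc (suc y') | _ = search-found f t xs j y e1

mutual
  run-sound : ∀ {k} (e : Code k) t xs y → run e t xs ≡ suc y → Eval e xs y
  run-sound zr t xs .0 refl = ev-zr
  run-sound sc t (x ∷ []) .(suc x) refl = ev-sc
  run-sound (proj i) t xs .(lookup xs i) refl = ev-proj
  run-sound (comp f gs) t xs y e with runAll-sound gs t xs _ y e
  ... | args , f-runs = ev-comp args (run-sound f t _ y f-runs)
  run-sound (prec f g) t (n ∷ xs) y e = runPrec-sound f g t n xs y e
  run-sound (mu f) t xs y e with search f t xs t in e1
  run-sound (mu f) t xs y () | zero
  run-sound (mu f) t xs y () | suc zero
  run-sound (mu f) t xs y refl | suc (suc y') with search-found f t xs t y' e1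
  ... | zero-at-y , positive-below =
    ev-mu (run-sound f t _ 0 zero-at-y)
          (λ z z<y → proj₁ (positive-below z z<y) , run-sound f t _ _ (proj₂ (positive-below z z<y)))

  runAll-sound : ∀ {k m} (gs : Vec (Code k) m) t xs b y → guardAll (runAll gs t xs) b ≡ suc y →
    EvalAll gs xs (predAll (runAll gs t xs)) × b ≡ suc y
  runAll-sound [] t xs b y e = [] , e
  runAll-sound (g ∷ gs) t xs b y e with run g t xs in e1
  runAll-sound (g ∷ gs) t xs b y () | zero
  runAll-sound (g ∷ gs) t xs b y e | suc v with runAll-sound gs t xs b y e
  ... | args , b≡ = (run-sound g t xs v e1 ∷ args) , b≡

  runPrec-sound : ∀ {k} (f : Code k) g t n xs y → runPrec f g t n xs ≡ suc y → Eval (prec f g) (n ∷ xs) y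
  runPrec-sound f g t zero xs y e = ev-prec0 (run-sound f t xs y e)
  runPrec-sound f g t (suc n) xs y e with runPrec f g t n xs in e1
  runPrec-sound f g t (suc n) xs y () | zero
  runPrec-sound f g t (suc n) xs y e | suc r = ev-precS (runPrec-sound f g t n xs r e1) (run-sound g t _ y e)

Eventually : (ℕ → Set) → Set
Eventually P = Σ ℕ λ T → ∀ t → T ≤ t → P t

eventually-∧ : ∀ {P Q} → Eventually P → Eventually Q → Eventually (λ t → P t × Q t)
eventually-∧ (T1 , p) (T2 , q) = T1 ⊔ T2 , λ t le → p t (≤-trans (m≤m⊔n T1 T2) le) , q t (≤-trans (m≤n⊔m T1 T2) le)

eventually-map : ∀ {P Q : ℕ → Set} → (∀ t → P t → Q t) → Eventually P → Eventually Q
eventually-map f (T , p) = T , λ t le → f t (p t le)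

eventually-below : ∀ y (P : ℕ → ℕ → Set) → (∀ z → z < y → Eventually (P z)) →
  Eventually (λ t → ∀ z → z < y → P z t)
eventually-below zero P h = 0 , λ t _ z ()
eventually-below (suc y) P h =
  eventually-map combine (eventually-∧ (eventually-below y P (λ z z<y → h z (m<n⇒m<1+n z<y))) (h y ≤-refl))
  where
  combine : ∀ t → (∀ z → z < y → P z t) × P y t → ∀ z → z < suc y → P z t
  combine t (below , at-y) z z<1+y with m<1+n⇒m<n∨m≡n z<1+y
  ... | inj₁ z<y = below z z<y
  ... | inj₂ refl = at-y

guardAll-suc : ∀ {m} (ys : Vec ℕ m) b → guardAll (map suc ys) b ≡ b
guardAll-suc [] b = refl
guardAll-suc (y ∷ ys) b = guardAll-suc ys b

predAll-suc : ∀ {m} (ys : Vec ℕ m) → predAll (map suc ys) ≡ ys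
predAll-suc [] = refl
predAll-suc (y ∷ ys) = cong (y ∷_) (predAll-suc ys)

search-before : ∀ {k} (f : Code (suc k)) t xs y → (∀ z → z < y → PositiveAt f t xs z) →
  ∀ j → j ≤ y → search f t xs j ≡ 1
search-before f t xs y positive zero j≤y = refl
search-before f t xs y positive (suc j) j<y
  with search-before f t xs y positive j (≤-trans (n≤1+n j) j<y) | positive j j<y
... | going | v , positive-j rewrite going | positive-j = refl

search-after : ∀ {k} (f : Code (suc k)) t xs y → (∀ z → z < y → PositiveAt f t xs z) →
  run f t (y ∷ xs) ≡ 1 → ∀ j → suc y ≤ j → search f t xs j ≡ suc (suc y)
search-after f t xs y positive zero-at-y (suc j) (s≤s y≤j) with m≤n⇒m<n∨m≡n y≤j
... | inj₂ refl rewrite search-before f t xs y positive y ≤-refl | zero-at-y = refl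
... | inj₁ y<j rewrite search-after f t xs y positive zero-at-y j y<j = refl

mutual
  run-complete : ∀ {k} {e : Code k} {xs y} → Eval e xs y → Eventually (λ t → run e t xs ≡ suc y)
  run-complete ev-zr = 0 , λ t _ → refl
  run-complete ev-sc = 0 , λ t _ → refl
  run-complete ev-proj = 0 , λ t _ → refl
  run-complete {e = comp f gs} {xs} {y} (ev-comp {ys = ys} args f-ev) =
    eventually-map combine (eventually-∧ (runAll-complete args) (run-complete f-ev))
    where
    combine : ∀ t → runAll gs t xs ≡ map suc ys × run f t ys ≡ suc y → run (comp f gs) t xs ≡ suc y
    combine t (args≡ , f≡) rewrite args≡ | guardAll-suc ys (run f t (predAll (map suc ys))) | predAll-suc ys = f≡
  run-complete (ev-prec0 f-ev) = run-complete f-ev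
  run-complete {e = prec f g} {suc n ∷ xs} {y} (ev-precS {r = r} rec-ev g-ev) =
    eventually-map combine (eventually-∧ (run-complete rec-ev) (run-complete g-ev))
    where
    combine : ∀ t → runPrec f g t n xs ≡ suc r × run g t (n ∷ r ∷ xs) ≡ suc y → runPrec f g t (suc n) xs ≡ suc y
    combine t (rec≡ , g≡) rewrite rec≡ = g≡
  run-complete {e = mu f} {xs} {y} (ev-mu zero-ev positive-ev) =
    eventually-map combine (eventually-∧ (eventually-∧ (run-complete zero-ev) positive) (suc y , λ t le → le))
    where
    positive : Eventually (λ t → ∀ z → z < y → PositiveAt f t xs z)
    positive = eventually-below y (λ z t → PositiveAt f t xs z)
      (λ z z<y → eventually-map (λ t e → _ , e) (run-complete (proj₂ (positive-ev z z<y))))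
    combine : ∀ t → (run f t (y ∷ xs) ≡ 1 × (∀ z → z < y → PositiveAt f t xs z)) × suc y ≤ t →
      search f t xs t ∸ 1 ≡ suc y
    combine t ((zero-at-y , pos) , y<t) rewrite search-after f t xs y pos zero-at-y t y<t = refl

  runAll-complete : ∀ {k m} {gs : Vec (Code k) m} {xs ys} → EvalAll gs xs ys →
    Eventually (λ t → runAll gs t xs ≡ map suc ys)
  runAll-complete [] = 0 , λ t _ → refl
  runAll-complete (a ∷ as) =
    eventually-map (λ t (e , es) → cong₂ _∷_ e es) (eventually-∧ (run-complete a) (runAll-complete as))

searchStepC : Code 3
searchStepC =
  ap3 condC (ap2 eqC x0 (const 1))
            (ap2 gdC x1 (ap3 condC (ap2 eqC x1 (const 1)) (ap1 sc (ap1 sc x2)) (const 1)))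
            x0

computes-searchStep : Computes searchStepC (λ { (s ∷ v ∷ k ∷ []) → searchStep s v k })
computes-searchStep = computes-ext (λ { (s ∷ v ∷ k ∷ []) → refl })
  (computes-ap3 computes-cond
    (computes-ap2 computes-eq (computes-proj fz) (computes-const 1))
    (computes-ap2 computes-gd (computes-proj (fs fz))
      (computes-ap3 computes-cond (computes-ap2 computes-eq (computes-proj (fs fz)) (computes-const 1))
        (computes-ap1 computes-sc (computes-ap1 computes-sc (computes-proj (fs (fs fz)))))
        (computes-const 1)))
    (computes-proj fz))

drop-args : ∀ {n k} → (Fin k → Fin n) → Vec (Code n) k
drop-args ρ = tabulate (λ i → proj (ρ i))

eval-drop-args : ∀ {n k} (ρ : Fin k → Fin n) xs → EvalAll (drop-args ρ) xs (tabulate (λ i → lookup xs (ρ i)))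
eval-drop-args {k = zero} ρ xs = []
eval-drop-args {k = suc k} ρ xs = ev-proj ∷ eval-drop-args (λ i → ρ (fs i)) xs

drop1 : ∀ {k} → Vec (Code (suc k)) k
drop1 = drop-args fs

drop2 : ∀ {k} → Vec (Code (suc (suc k))) k
drop2 = drop-args (λ i → fs (fs i))

drop3 : ∀ {k} → Vec (Code (suc (suc (suc k)))) k
drop3 = drop-args (λ i → fs (fs (fs i)))

eval-drop1 : ∀ {k} a (xs : Vec ℕ k) → EvalAll drop1 (a ∷ xs) xs
eval-drop1 a xs = subst (EvalAll drop1 (a ∷ xs)) (tabulate∘lookup xs) (eval-drop-args fs (a ∷ xs))

eval-drop2 : ∀ {k} a b (xs : Vec ℕ k) → EvalAll drop2 (a ∷ b ∷ xs) xs
eval-drop2 a b xs = subst (EvalAll drop2 (a ∷ b ∷ xs)) (tabulate∘lookup xs) (eval-drop-args _ (a ∷ b ∷ xs))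

eval-drop3 : ∀ {k} a b c (xs : Vec ℕ k) → EvalAll drop3 (a ∷ b ∷ c ∷ xs) xs
eval-drop3 a b c xs = subst (EvalAll drop3 (a ∷ b ∷ c ∷ xs)) (tabulate∘lookup xs) (eval-drop-args _ (a ∷ b ∷ c ∷ xs))

guardAllC : ∀ {n m} → Vec (Code n) m → Code n → Code n
guardAllC [] b = b
guardAllC (g ∷ gs) b = ap2 gdC g (guardAllC gs b)

eval-guardAll : ∀ {n m} {cs : Vec (Code n) m} {b xs vs bv} →
  EvalAll cs xs vs → Eval b xs bv → Eval (guardAllC cs b) xs (guardAll vs bv)
eval-guardAll [] b = b
eval-guardAll (c ∷ cs) b = ev-comp (c ∷ eval-guardAll cs b ∷ []) (computes-gd _)

predAllC : ∀ {n m} → Vec (Code n) m → Vec (Code n) m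
predAllC = map (ap1 predC)

eval-predAll : ∀ {n m} {cs : Vec (Code n) m} {xs vs} → EvalAll cs xs vs → EvalAll (predAllC cs) xs (predAll vs)
eval-predAll [] = []
eval-predAll (c ∷ cs) = ev-comp (c ∷ []) (computes-pred _) ∷ eval-predAll cs

mutual
  runCode : ∀ {k} → Code k → Code (suc k)
  runCode zr = const 1
  runCode sc = ap1 sc (ap1 sc x1)
  runCode (proj i) = ap1 sc (proj (fs i))
  runCode (comp f gs) = guardAllC (runCodes gs) (comp (runCode f) (x0 ∷ predAllC (runCodes gs)))
  runCode (prec f g) =
    comp (prec (runCode f) (ap2 gdC x1 (comp (runCode g) (x2 ∷ x0 ∷ ap1 predC x1 ∷ drop3)))) (x1 ∷ x0 ∷ drop2)
  runCode (mu f) =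
    ap1 predC (comp (prec (const 1) (ap3 searchStepC x1 (comp (runCode f) (x2 ∷ x0 ∷ drop3)) x0)) (x0 ∷ x0 ∷ drop1))

  runCodes : ∀ {k m} → Vec (Code k) m → Vec (Code (suc k)) m
  runCodes [] = []
  runCodes (g ∷ gs) = runCode g ∷ runCodes gs

mutual
  eval-runCode : ∀ {k} (e : Code k) t xs → Eval (runCode e) (t ∷ xs) (run e t xs)
  eval-runCode zr t xs = computes-const 1 _
  eval-runCode sc t (x ∷ []) = ev-comp (ev-comp (ev-proj ∷ []) ev-sc ∷ []) ev-sc
  eval-runCode (proj i) t xs = ev-comp (ev-proj ∷ []) ev-sc
  eval-runCode (comp f gs) t xs =
    eval-guardAll (eval-runCodes gs t xs) (ev-comp (ev-proj ∷ eval-predAll (eval-runCodes gs t xs)) (eval-runCode f t _))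
  eval-runCode (prec f g) t (n ∷ xs) = ev-comp (ev-proj ∷ ev-proj ∷ eval-drop2 t n xs) (loop n)
    where
    loop : ∀ n → Eval (prec (runCode f) (ap2 gdC x1 (comp (runCode g) (x2 ∷ x0 ∷ ap1 predC x1 ∷ drop3))))
                      (n ∷ t ∷ xs) (runPrec f g t n xs)
    loop zero = ev-prec0 (eval-runCode f t xs)
    loop (suc n) = ev-precS (loop n)
      (ev-comp (ev-proj ∷ ev-comp (ev-proj ∷ ev-proj ∷ ev-comp (ev-proj ∷ []) (computes-pred _) ∷ eval-drop3 n _ t xs)
                                  (eval-runCode g t _) ∷ [])
               (computes-gd _))
  eval-runCode (mu f) t xs = ev-comp (ev-comp (ev-proj ∷ ev-proj ∷ eval-drop1 t xs) (loop t) ∷ []) (computes-pred _)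
    where
    loop : ∀ j → Eval (prec (const 1) (ap3 searchStepC x1 (comp (runCode f) (x2 ∷ x0 ∷ drop3)) x0))
                      (j ∷ t ∷ xs) (search f t xs j)
    loop zero = ev-prec0 (computes-const 1 _)
    loop (suc j) = ev-precS (loop j)
      (ev-comp (ev-proj ∷ ev-comp (ev-proj ∷ ev-proj ∷ eval-drop3 j _ t xs) (eval-runCode f t _) ∷ ev-proj ∷ [])
               (computes-searchStep _))

  eval-runCodes : ∀ {k m} (gs : Vec (Code k) m) t xs → EvalAll (runCodes gs) (t ∷ xs) (runAll gs t xs)
  eval-runCodes [] t xs = []
  eval-runCodes (g ∷ gs) t xs = eval-runCode g t xs ∷ eval-runCodes gs t xs

computes-run : ∀ (p : Code 1) → Computes (runCode p) (λ { (t ∷ x ∷ []) → run p t (x ∷ []) })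
computes-run p (t ∷ x ∷ []) = eval-runCode p t (x ∷ [])

LeastWitness : (ℕ → Set) → Set
LeastWitness Q = Σ ℕ λ y → Q y × (∀ z → z < y → ¬ Q z)

scan : (Q : ℕ → Set) → (∀ z → Dec (Q z)) → ∀ b → LeastWitness Q ⊎ (∀ z → z < b → ¬ Q z)
scan Q Q? zero = inj₂ (λ z ())
scan Q Q? (suc b) with scan Q Q? b
... | inj₁ w = inj₁ w
... | inj₂ none-below with Q? b
... | yes qb = inj₁ (b , qb , none-below)
... | no ¬qb = inj₂ none-upto
  where
  none-upto : ∀ z → z < suc b → ¬ Q z
  none-upto z z<1+b with m<1+n⇒m<n∨m≡n z<1+b
  ... | inj₁ z<b = none-below z z<b
  ... | inj₂ refl = ¬qb

least-witness : (Q : ℕ → Set) → (∀ z → Dec (Q z)) → ∀ t → Q t → LeastWitness Q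
least-witness Q Q? t qt with scan Q Q? (suc t)
... | inj₁ w = w
... | inj₂ none = ⊥-elim (none t ≤-refl qt)

mu-halts : ∀ {f : Code 2} {F} → Computes f F → ∀ x t → F (t ∷ x ∷ []) ≡ 0 → W (mu f) x
mu-halts {f} {F} f-computes x t zero-at-t
  with least-witness (λ t → F (t ∷ x ∷ []) ≡ 0) (λ t → F (t ∷ x ∷ []) ≟ 0) t zero-at-t
... | y , zero-at-y , nonzero-below = y , ev-mu (subst (Eval f (y ∷ x ∷ [])) zero-at-y (f-computes _)) positive
  where
  positive : ∀ z → z < y → Σ ℕ λ v → Eval f (z ∷ x ∷ []) (suc v)
  positive z z<y with F (z ∷ x ∷ []) in Fz
  ... | zero = ⊥-elim (nonzero-below z z<y Fz)
  ... | suc v = v , subst (Eval f (z ∷ x ∷ [])) Fz (f-computes _)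

Produces : Code 1 → ℕ → ℕ → Set
Produces e t x = Σ ℕ λ v → run e t (x ∷ []) ≡ suc v

produces-halts : ∀ e t x → Produces e t x → W e x
produces-halts e t x (v , produced) = v , run-sound e t _ v produced

halts-produces : ∀ e x → W e x → Σ ℕ λ t → Produces e t x
halts-produces e x (v , ev) with run-complete ev
... | T , produced = T , v , produced T ≤-refl

-- Dovetailing two codes: `raceC p q` searches for a budget t at which the
-- bounded run of p or of q on x has produced a value, i.e. at which
-- nsg (run p t x + run q t x) vanishes.
runSum : Code 1 → Code 1 → ℕ → ℕ → ℕ
runSum p q t x = run p t (x ∷ []) + run q t (x ∷ [])

raceTest : Code 1 → Code 1 → Code 2
raceTest p q = ap1 nsgC (ap2 addC (runCode p) (runCode q))

computes-raceTest : ∀ p q → Computes (raceTest p q) (λ { (t ∷ x ∷ []) → nsg (runSum p q t x) })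
computes-raceTest p q = computes-ext (λ { (t ∷ x ∷ []) → refl })
  (computes-ap1 computes-nsg (computes-ap2 computes-add (computes-run p) (computes-run q)))

raceC : Code 1 → Code 1 → Code 1
raceC p q = mu (raceTest p q)

raceTest-zero : ∀ p q t x → nsg (runSum p q t x) ≡ 0 → Produces p t x ⊎ Produces q t x
raceTest-zero p q t x stop with run p t (x ∷ []) | run q t (x ∷ [])
... | suc v | _ = inj₁ (v , refl)
... | zero | suc w = inj₂ (w , refl)
raceTest-zero p q t x () | zero | zero

zero-raceTest : ∀ p q t x → Produces p t x ⊎ Produces q t x → nsg (runSum p q t x) ≡ 0
zero-raceTest p q t x (inj₁ (v , produced)) rewrite produced = refl
zero-raceTest p q t x (inj₂ (w , produced)) rewrite produced | +-suc (run p t (x ∷ [])) w = refl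

race-budget : ∀ p q x t → Eval (raceC p q) (x ∷ []) t → Produces p t x ⊎ Produces q t x
race-budget p q x t (ev-mu stop _) =
  raceTest-zero p q t x (sym (eval-det stop (computes-raceTest p q (t ∷ x ∷ []))))

race-halts : ∀ p q x → W p x ⊎ W q x → W (raceC p q) x
race-halts p q x (inj₁ halts) with halts-produces p x halts
... | t , produced = mu-halts (computes-raceTest p q) x t (zero-raceTest p q t x (inj₁ produced))
race-halts p q x (inj₂ halts) with halts-produces q x halts
... | t , produced = mu-halts (computes-raceTest p q) x t (zero-raceTest p q t x (inj₂ produced))

domain-code : ∀ (c : Code 1) → CodeFor (W c)
domain-code c = record { code = c ; dom⊆ = λ x x∈W → x∈W ; dom⊇ = λ x x∈W → x∈W }

ce-∪ : ∀ {P Q} → CodeFor P → CodeFor Q → CodeFor (P ∪ Q)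
ce-∪ {P} {Q} cP cQ = record { code = raceC (code cP) (code cQ) ; dom⊆ = sound ; dom⊇ = complete }
  where
  sound : ∀ x → W (raceC (code cP) (code cQ)) x → (P ∪ Q) x
  sound x (t , race) with race-budget (code cP) (code cQ) x t race
  ... | inj₁ produced = inj₁ (dom⊆ cP x (produces-halts _ t x produced))
  ... | inj₂ produced = inj₂ (dom⊆ cQ x (produces-halts _ t x produced))
  complete : ∀ x → (P ∪ Q) x → W (raceC (code cP) (code cQ)) x
  complete x (inj₁ p) = race-halts (code cP) (code cQ) x (inj₁ (dom⊇ cP x p))
  complete x (inj₂ q) = race-halts (code cP) (code cQ) x (inj₂ (dom⊇ cQ x q))

-- A c.e. set whose complement is c.e. is computable: race p against q
-- and report whether p was the one that produced a value.
complemented-computable : ∀ p q → Disjoint (W p) (W q) → (∀ x → W p x ⊎ W q x) → Computable (W p)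
complemented-computable p q disjoint cover = comp (ap1 sgC (runCode p)) (raceC p q ∷ x0 ∷ []) , decide
  where
  output : ∀ x t → Eval (raceC p q) (x ∷ []) t →
    Eval (comp (ap1 sgC (runCode p)) (raceC p q ∷ x0 ∷ [])) (x ∷ []) (sg (run p t (x ∷ [])))
  output x t race = ev-comp (race ∷ ev-proj ∷ []) (ev-comp (eval-runCode p t (x ∷ []) ∷ []) (computes-sg _))
  decide : ∀ x → (W p x × Eval _ (x ∷ []) 1) ⊎ (¬ W p x × Eval _ (x ∷ []) 0)
  decide x with race-halts p q x (cover x)
  ... | t , race with run p t (x ∷ []) in run-p | output x t race
  ... | suc v | out = inj₁ ((v , run-sound p t _ v run-p) , out)
  ... | zero | out with race-budget p q x t race
  ... | inj₁ (v , produced) = ⊥-elim (0≢1+n (trans (sym run-p) produced))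
  ... | inj₂ produced = inj₂ ((λ in-p → disjoint x in-p (produces-halts q t x produced)) , out)

-- A number n is read, via Cantor unpairing, as a tag and a payload; since the
-- arity of the subcodes of a composition is itself part of the data, decoding
-- is driven by an explicit fuel argument, and every code is the decoding of a
-- fixed number for all sufficiently large fuel.

cantorStep : ℕ × ℕ → ℕ × ℕ
cantorStep (zero , b) = suc b , 0
cantorStep (suc a , b) = a , suc b

-- unpair walks the diagonals a + b = s from (s , 0) down to (0 , s).
unpair : ℕ → ℕ × ℕ
unpair zero = 0 , 0
unpair (suc n) = cantorStep (unpair n)

unpair-diagonal : ∀ s a b → a + b ≡ s → Σ ℕ λ n → unpair n ≡ (a , b)
unpair-diagonal s a (suc b) a+b≡s with unpair-diagonal s (suc a) b (trans (sym (+-suc a b)) a+b≡s)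
... | n , e = suc n , cong cantorStep e
unpair-diagonal zero zero zero _ = 0 , refl
unpair-diagonal (suc s) (suc a) zero a+0≡s
  with unpair-diagonal s zero a (suc-injective (trans (cong suc (sym (+-identityʳ a))) a+0≡s))
... | n , e = suc n , cong cantorStep e

unpair-onto : ∀ a b → Σ ℕ λ n → unpair n ≡ (a , b)
unpair-onto a b = unpair-diagonal (a + b) a b refl

fst snd : ℕ → ℕ
fst n = proj₁ (unpair n)
snd n = proj₂ (unpair n)

-- The number p read as an element of Fin (suc k) (clamped at the top).
toFin : ∀ k → ℕ → Fin (suc k)
toFin k zero = fz
toFin zero (suc p) = fz
toFin (suc k) (suc p) = fs (toFin k p)

toFin-toℕ : ∀ k (i : Fin (suc k)) → toFin k (toℕ i) ≡ i
toFin-toℕ k fz = refl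
toFin-toℕ (suc k) (fs i) = cong fs (toFin-toℕ k i)

scOrZero : ∀ k → Code k
scOrZero (suc zero) = sc
scOrZero _ = zr

projOrZero : ∀ k → ℕ → Code k
projOrZero zero p = zr
projOrZero (suc k) p = proj (toFin k p)

-- Tags: 0 zr, 1 sc, 2 proj, 3 comp (payload: m, f, gs), 4 prec, 5 mu.
mutual
  decode : ℕ → ∀ k → ℕ → Code k
  decode zero k n = zr
  decode (suc f) k n = decodeTagged f k (fst n) (snd n)

  decodeTagged : ℕ → ∀ k → ℕ → ℕ → Code k
  decodeTagged f k 0 p = zr
  decodeTagged f k 1 p = scOrZero k
  decodeTagged f k 2 p = projOrZero k p
  decodeTagged f k 3 p = comp (decode f (fst p) (fst (snd p))) (decodeVec f k (fst p) (snd (snd p)))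
  decodeTagged f k 4 p = decodePrec f k p
  decodeTagged f k 5 p = mu (decode f (suc k) p)
  decodeTagged f k _ p = zr

  decodePrec : ℕ → ∀ k → ℕ → Code k
  decodePrec f zero p = zr
  decodePrec f (suc k) p = prec (decode f k (fst p)) (decode f (suc (suc k)) (snd p))

  decodeVec : ℕ → ∀ k m → ℕ → Vec (Code k) m
  decodeVec f k zero q = []
  decodeVec f k (suc m) q = decode f k (fst q) ∷ decodeVec f k m (snd q)

Decodes : ∀ {k} → Code k → ℕ → Set
Decodes {k} c n = Eventually (λ f → decode f k n ≡ c)

DecodesVec : ∀ {k m} → Vec (Code k) m → ℕ → Set
DecodesVec {k} {m} cs n = Eventually (λ f → decodeVec f k m n ≡ cs)

-- Adding one unit of fuel (spent on reading the tag).
eventually-pred : ∀ {P : ℕ → Set} → Eventually (λ f → P (suc f)) → Eventually P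
eventually-pred (T , p) = suc T , λ { (suc f) (s≤s T≤f) → p f T≤f }

via-unpair : ∀ {A : Set} (F : ℕ → ℕ → A) {n a b} → unpair n ≡ (a , b) → F (fst n) (snd n) ≡ F a b
via-unpair F e = cong (λ z → F (proj₁ z) (proj₂ z)) e

tagged : ∀ {k} (c : Code k) tag p → Eventually (λ f → decodeTagged f k tag p ≡ c) → Σ ℕ (Decodes c)
tagged {k} c tag p decodes with unpair-onto tag p
... | n , unpair-n = n , eventually-pred
  (eventually-map (λ f e → trans (via-unpair (decodeTagged f k) {n} unpair-n) e) decodes)

mutual
  decode-onto : ∀ {k} (c : Code k) → Σ ℕ (Decodes c)
  decode-onto zr = tagged zr 0 0 (0 , λ f _ → refl)
  decode-onto sc = tagged sc 1 0 (0 , λ f _ → refl)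
  decode-onto {suc k} (proj i) = tagged (proj i) 2 (toℕ i) (0 , λ f _ → cong proj (toFin-toℕ k i))
  decode-onto {k} (comp {m = m} g gs) with decode-onto g | decodeVec-onto gs
  ... | a , decodes-g | b , decodes-gs with unpair-onto a b
  ... | q , unpair-q with unpair-onto m q
  ... | p , unpair-p = tagged (comp g gs) 3 p (eventually-map reassemble (eventually-∧ decodes-g decodes-gs))
    where
    reassemble : ∀ f → decode f m a ≡ g × decodeVec f k m b ≡ gs → decodeTagged f k 3 p ≡ comp g gs
    reassemble f (g≡ , gs≡) =
      trans (via-unpair (λ m' q' → comp (decode f m' (fst q')) (decodeVec f k m' (snd q'))) {p} unpair-p)
      (trans (via-unpair (λ a' b' → comp (decode f m a') (decodeVec f k m b')) {q} unpair-q)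
             (cong₂ comp g≡ gs≡))
  decode-onto {suc k} (prec g h) with decode-onto g | decode-onto h
  ... | a , decodes-g | b , decodes-h with unpair-onto a b
  ... | p , unpair-p = tagged (prec g h) 4 p (eventually-map reassemble (eventually-∧ decodes-g decodes-h))
    where
    reassemble : ∀ f → decode f k a ≡ g × decode f (suc (suc k)) b ≡ h → decodeTagged f (suc k) 4 p ≡ prec g h
    reassemble f (g≡ , h≡) =
      trans (via-unpair (λ a' b' → prec (decode f k a') (decode f (suc (suc k)) b')) {p} unpair-p) (cong₂ prec g≡ h≡)
  decode-onto (mu g) with decode-onto g
  ... | a , decodes-g = tagged (mu g) 5 a (eventually-map (λ f → cong mu) decodes-g)

  decodeVec-onto : ∀ {k m} (cs : Vec (Code k) m) → Σ ℕ (DecodesVec cs)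
  decodeVec-onto [] = 0 , 0 , λ f _ → refl
  decodeVec-onto {k} {suc m} (c ∷ cs) with decode-onto c | decodeVec-onto cs
  ... | a , decodes-c | b , decodes-cs with unpair-onto a b
  ... | q , unpair-q = q , eventually-map reassemble (eventually-∧ decodes-c decodes-cs)
    where
    reassemble : ∀ f → decode f k a ≡ c × decodeVec f k m b ≡ cs → decodeVec f k (suc m) q ≡ c ∷ cs
    reassemble f (c≡ , cs≡) = trans (via-unpair (λ a' b' → decode f k a' ∷ decodeVec f k m b') {q} unpair-q) (cong₂ _∷_ c≡ cs≡)

enumerate : ℕ → Code 1
enumerate n = decode (fst n) 1 (snd n)

enumerate-onto : ∀ c → Σ ℕ λ n → enumerate n ≡ c
enumerate-onto c with decode-onto c
... | m , T , decodes with unpair-onto T m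
... | n , unpair-n = n , trans (via-unpair (λ f m' → decode f 1 m') {n} unpair-n) (decodes T ≤-refl)

-- It implies X ⊆* Y outright, and (classically) is equivalent to it, but it is
-- the form in which almost-inclusions are composed below.
_⊆ᵉ_ : Pred → Pred → Set
X ⊆ᵉ Y = Σ ℕ λ n → ∀ x → n ≤ x → X x → Y x

⊆⇒⊆ᵉ : ∀ {X Y} → (∀ x → X x → Y x) → X ⊆ᵉ Y
⊆⇒⊆ᵉ X⊆Y = 0 , λ x _ → X⊆Y x

⊆ᵉ-trans : ∀ {X Y Z} → X ⊆ᵉ Y → Y ⊆ᵉ Z → X ⊆ᵉ Z
⊆ᵉ-trans (n , X⊆Y) (m , Y⊆Z) =
  n ⊔ m , λ x le x∈X → Y⊆Z x (≤-trans (m≤n⊔m n m) le) (X⊆Y x (≤-trans (m≤m⊔n n m) le) x∈X)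

⊆ᵉ-refine : ∀ {X Y Z} → X ⊆ᵉ Y → (∀ x → X x → Y x → Z x) → X ⊆ᵉ Z
⊆ᵉ-refine (n , X⊆Y) refine = n , λ x le x∈X → refine x x∈X (X⊆Y x le x∈X)

⊆ᵉ-∪ : ∀ {Z X Y} → X ⊆ᵉ Y → (Z ∪ X) ⊆ᵉ (Z ∪ Y)
⊆ᵉ-∪ (n , X⊆Y) = n , λ { x le (inj₁ x∈Z) → inj₁ x∈Z ; x le (inj₂ x∈X) → inj₂ (X⊆Y x le x∈X) }

⊆ᵉ⇒⊆* : ∀ {X Y} → X ⊆ᵉ Y → X ⊆* Y
⊆ᵉ⇒⊆* {X} {Y} (n , X⊆Y) = n , below
  where
  below : ∀ x → X x × ¬ Y x → x < n
  below x (x∈X , x∉Y) with x <? n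
  ... | yes x<n = x<n
  ... | no x≮n = ⊥-elim (x∉Y (X⊆Y x (≮⇒≥ x≮n) x∈X))

cofinite-⊆ᵉ : ∀ {X Y} → Cofinite X → X ⊆ᵉ Y → Cofinite Y
cofinite-⊆ᵉ (n , X-above) (m , X⊆Y) =
  n ⊔ m , λ x le → X⊆Y x (≤-trans (m≤n⊔m n m) le) (X-above x (≤-trans (m≤m⊔n n m) le))

⊆ᵉ∅⇒finite : ∀ {X} → X ⊆ᵉ ∅ → Finite X
⊆ᵉ∅⇒finite {X} (n , X⊆∅) = n , below
  where
  below : ∀ x → X x → x < n
  below x x∈X with x <? n
  ... | yes x<n = x<n
  ... | no x≮n = ⊥-elim (X⊆∅ x (≮⇒≥ x≮n) x∈X)

infinite-⊈ᵉ∅ : ∀ {X} → Infinite X → ¬ (X ⊆ᵉ ∅)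
infinite-⊈ᵉ∅ inf (n , X⊆∅) with inf n
... | x , n≤x , x∈X = X⊆∅ x n≤x x∈X

-- Finite unions of an indexed family.  An index beyond the sum of a list of
-- indices is `fresh` for it: if the family is pairwise disjoint, the fresh
-- member is disjoint from the union.
index-≤-sum : ∀ {P : ℕ → Set} {is : List ℕ} → Any P is → Σ ℕ λ i → i ≤ sum is × P i
index-≤-sum {is = i ∷ is} (here p) = i , m≤m+n i (sum is) , p
index-≤-sum {is = i ∷ is} (there p) with index-≤-sum p
... | j , j≤sum , pj = j , ≤-trans j≤sum (m≤n+m (sum is) i) , pj

fresh : List ℕ → ℕ
fresh is = suc (sum is)

PairwiseDisjoint : {I : Set} → (I → Pred) → Set
PairwiseDisjoint {I} G = ∀ (i j : I) → ¬ i ≡ j → Disjoint (G i) (G j)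

fresh-disjoint : ∀ (R : ℕ → Pred) → PairwiseDisjoint R → ∀ is → Disjoint (⋃ R is) (R (fresh is))
fresh-disjoint R disjoint is x x∈⋃ x∈fresh with index-≤-sum x∈⋃
... | i , i≤sum , x∈Ri = disjoint i (fresh is) (λ i≡ → 1+n≰n (subst (_≤ sum is) i≡ i≤sum)) x x∈Ri x∈fresh

⋃-disjoint : ∀ {I : Set} (G : I → Pred) {A : Pred} → (∀ i → Disjoint (G i) A) → ∀ is → Disjoint (⋃ G is) A
⋃-disjoint G G∩A=∅ (i ∷ is) x (here x∈Gi) = G∩A=∅ i x x∈Gi
⋃-disjoint G G∩A=∅ (i ∷ is) x (there x∈⋃) = ⋃-disjoint G G∩A=∅ is x x∈⋃

⋃-const : ∀ {P : Pred} {I : Set} (is : List I) x → ⋃ (λ _ → P) is x → P x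
⋃-const (i ∷ is) x (here p) = p
⋃-const {P} (i ∷ is) x (there p) = ⋃-const {P} is x p

justs : List (Maybe ℕ) → List ℕ
justs [] = []
justs (nothing ∷ is) = justs is
justs (just i ∷ is) = i ∷ justs is

⋃-split : ∀ (G : Maybe ℕ → Pred) is x → ⋃ G is x → G nothing x ⊎ ⋃ (λ i → G (just i)) (justs is) x
⋃-split G (nothing ∷ is) x (here p) = inj₁ p
⋃-split G (just i ∷ is) x (here p) = inj₂ (here p)
⋃-split G (nothing ∷ is) x (there p) = ⋃-split G is x p
⋃-split G (just i ∷ is) x (there p) with ⋃-split G is x p
... | inj₁ p' = inj₁ p'
... | inj₂ p' = inj₂ (there p')

computable-⋃ : ∀ (R : ℕ → Pred) → (∀ i → Computable (R i)) → ∀ is → Computable (⋃ R is)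
computable-⋃ R computable [] = computable-ext (λ x ()) (λ x ()) computable-∅
computable-⋃ R computable (i ∷ is) = computable-ext into out (computable-∪ (computable i) (computable-⋃ R computable is))
  where
  into : ∀ x → (R i ∪ ⋃ R is) x → ⋃ R (i ∷ is) x
  into x (inj₁ p) = here p
  into x (inj₂ p) = there p
  out : ∀ x → ⋃ R (i ∷ is) x → (R i ∪ ⋃ R is) x
  out x (here p) = inj₁ p
  out x (there p) = inj₂ p

⋃W : (ℕ → Code 1) → List ℕ → Pred
⋃W R is = ⋃ (λ i → W (R i)) is

record Blocks (H : Pred) (R : ℕ → Code 1) : Set where
  field
    block-computable : ∀ i → Computable (W (R i))
    block-infinite   : ∀ i → Infinite (W (R i))
    blocks-disjoint  : PairwiseDisjoint (λ i → W (R i))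
    block-avoids     : ∀ i → Disjoint (W (R i)) H
open Blocks

Exhausts : Pred → (List ℕ → Pred) → Set
Exhausts H U = ∀ (V : Code 1) → Disjoint (W V) H → Σ (List ℕ) λ is → W V ⊆ᵉ U is

type4-intro : ∀ {H} (R : ℕ → Code 1) → Blocks H R → Exhausts H (⋃W R) → HasType4 H
type4-intro R blocks exhausts =
  R , (λ i → block-infinite blocks i , block-computable blocks i) , blocks-disjoint blocks ,
  block-avoids blocks , λ V V∩H=∅ → let is , V⊆ = exhausts V V∩H=∅ in is , ⊆ᵉ⇒⊆* V⊆

record Type5Data (A : Pred) : Set where
  field
    D₀               : Code 1
    R                : ℕ → Code 1
    blocks           : Blocks (A ∪ W D₀) R
    D₀-infinite      : Infinite (W D₀)
    D₀-noncomputable : ¬ Computable (W D₀)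
    D₀-avoids        : Disjoint (W D₀) A
    exhausts         : Exhausts A (λ is → W D₀ ∪ ⋃W R is)

exhausts⇒covers : ∀ {A} (G : Maybe ℕ → Pred) (D₀ : Code 1) (R : ℕ → Code 1) →
  (∀ x → W D₀ x → G nothing x) → (∀ i x → W (R i) x → G (just i) x) →
  Exhausts A (λ is → W D₀ ∪ ⋃W R is) →
  ∀ (V : Code 1) → Disjoint (W V) A → Σ (List (Maybe ℕ)) λ js → W V ⊆* ⋃ G js
exhausts⇒covers G D₀ R D₀⊆G R⊆G exhausts V V∩A=∅ with exhausts V V∩A=∅
... | is , n , V⊆ = nothing ∷ List.map just is , ⊆ᵉ⇒⊆* (n , λ x n≤x x∈V → join is x (V⊆ x n≤x x∈V))
  where
  embed : ∀ is x → ⋃W R is x → ⋃ G (List.map just is) x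
  embed (i ∷ is) x (here x∈Ri) = here (R⊆G i x x∈Ri)
  embed (i ∷ is) x (there x∈⋃) = there (embed is x x∈⋃)
  join : ∀ is x → (W D₀ ∪ ⋃W R is) x → ⋃ G (nothing ∷ List.map just is) x
  join is x (inj₁ x∈D₀) = here (D₀⊆G x x∈D₀)
  join is x (inj₂ x∈⋃) = there (embed is x x∈⋃)

type5-intro : ∀ {A} → Type5Data A → HasType5 A
type5-intro {A} t = D₀ t , R t ,
  (λ { nothing → D₀-infinite t ; (just i) → block-infinite (blocks t) i }) ,
  (λ { nothing nothing nothing≢nothing → ⊥-elim (nothing≢nothing refl)
     ; nothing (just j) _ x x∈D₀ x∈Rj → block-avoids (blocks t) j x x∈Rj (inj₂ x∈D₀)
     ; (just i) nothing _ x x∈Ri x∈D₀ → block-avoids (blocks t) i x x∈Ri (inj₂ x∈D₀)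
     ; (just i) (just j) i≢j → blocks-disjoint (blocks t) i j (λ i≡j → i≢j (cong just i≡j)) }) ,
  D₀-noncomputable t , block-computable (blocks t) ,
  (λ { nothing → D₀-avoids t ; (just i) → λ x x∈Ri x∈A → block-avoids (blocks t) i x x∈Ri (inj₁ x∈A) }) ,
  exhausts⇒covers _ (D₀ t) (R t) (λ x x∈D₀ → x∈D₀) (λ i x x∈Ri → x∈Ri) (exhausts t)
  where open Type5Data

module Classical (em : ExcludedMiddle 0ℓ) where

  ⊆*⇒⊆ᵉ : ∀ {X Y} → X ⊆* Y → X ⊆ᵉ Y
  ⊆*⇒⊆ᵉ {X} {Y} (n , exceptions-below) = n , above
    where
    above : ∀ x → n ≤ x → X x → Y x
    above x n≤x x∈X with em {Y x}
    ... | yes x∈Y = x∈Y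
    ... | no x∉Y = ⊥-elim (<⇒≱ (exceptions-below x (x∈X , x∉Y)) n≤x)

  -- Classically every set has a decidable membership, so every bounded part
  -- of a set, and hence every finite set, is computable.
  computable-bounded-part : ∀ (P : Pred) n → Computable (λ x → x < n × P x)
  computable-bounded-part P = computable-bounded P (λ x → em)

  computable-finite : ∀ {P} → Finite P → Computable P
  computable-finite {P} (n , bounded) =
    computable-ext (λ x → proj₂) (λ x p → bounded x p , p) (computable-bounded-part P n)

  noncomputable⇒infinite : ∀ (X : Pred) → ¬ Computable X → Infinite X
  noncomputable⇒infinite X noncomputable n with em {Σ ℕ λ x → n ≤ x × X x}
  ... | yes witness = witness
  ... | no none = ⊥-elim (noncomputable (computable-finite (⊆ᵉ∅⇒finite (n , λ x n≤x x∈X → none (x , n≤x , x∈X)))))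

  -- If a c.e. set W p and a disjoint c.e. set Q together cover almost all
  -- numbers, W p is computable: the finitely many exceptions below the bound
  -- are added to Q, making W p and Q complementary.
  cofinitely-complemented-computable : ∀ (p : Code 1) {Q : Pred} → CodeFor Q →
    Disjoint (W p) Q → Cofinite (W p ∪ Q) → Computable (W p)
  cofinitely-complemented-computable p {Q} cQ p∩Q=∅ (n , covered) =
    complemented-computable p (code cQ') p∩Q'=∅ cover
    where
    Exceptions : Pred
    Exceptions x = x < n × ¬ W p x
    cQ' : CodeFor (Q ∪ Exceptions)
    cQ' = ce-∪ cQ (ceCode (computable-bounded-part (λ x → ¬ W p x) n))
    p∩Q'=∅ : Disjoint (W p) (W (code cQ'))
    p∩Q'=∅ x x∈p x∈Q' with dom⊆ cQ' x x∈Q'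
    ... | inj₁ x∈Q = p∩Q=∅ x x∈p x∈Q
    ... | inj₂ (_ , x∉p) = x∉p x∈p
    cover : ∀ x → W p x ⊎ W (code cQ') x
    cover x with x <? n | em {W p x}
    ... | _ | yes x∈p = inj₁ x∈p
    ... | yes x<n | no x∉p = inj₂ (dom⊇ cQ' x (inj₂ (x<n , x∉p)))
    ... | no x≮n | no x∉p with covered x (≮⇒≥ x≮n)
    ... | inj₁ x∈p = inj₁ x∈p
    ... | inj₂ x∈Q = inj₂ (dom⊇ cQ' x (inj₁ x∈Q))

  type4-elim : ∀ {H} → HasType4 H → Σ (ℕ → Code 1) λ R → Blocks H R × Exhausts H (⋃W R)
  type4-elim (R , infinite-computable , disjoint , avoids , covers) =
    R ,
    record { block-computable = λ i → proj₂ (infinite-computable i)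
           ; block-infinite = λ i → proj₁ (infinite-computable i)
           ; blocks-disjoint = disjoint
           ; block-avoids = avoids } ,
    λ V V∩H=∅ → let is , V⊆ = covers V V∩H=∅ in is , ⊆*⇒⊆ᵉ V⊆

  -- The family of a generating collection, read off from the generating
  -- property (HasType5 builds its family internally, so it cannot be named).
  family-of : ∀ {A I} {G : I → Pred} → Generates A {I} G → I → Pred
  family-of {G = G} _ = G

  type5-elim : ∀ {A} → HasType5 A → Type5Data A
  type5-elim {A} (D₀ , R , infinite , disjoint , D₀-noncomputable , R-computable , generates@(avoids , covers)) = record
    { D₀ = D₀
    ; R = R
    ; blocks = record
      { block-computable = R-computable
      ; block-infinite = λ i → infinite (just i)
      ; blocks-disjoint = λ i j i≢j → disjoint (just i) (just j) (λ e → i≢j (just-injective e))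
      ; block-avoids = λ { i x x∈Ri (inj₁ x∈A) → avoids (just i) x x∈Ri x∈A
                         ; i x x∈Ri (inj₂ x∈D₀) → disjoint (just i) nothing (λ ()) x x∈Ri x∈D₀ } }
    ; D₀-infinite = infinite nothing
    ; D₀-noncomputable = D₀-noncomputable
    ; D₀-avoids = avoids nothing
    ; exhausts = λ V V∩A=∅ →
        let js , V⊆* = covers V V∩A=∅ ; n , V⊆ = ⊆*⇒⊆ᵉ V⊆* in
        justs js , n , λ x n≤x x∈V → ⋃-split (family-of generates) js x (V⊆ x n≤x x∈V)
    }

  SeparatorOf : Pred → Code 1 → Set
  SeparatorOf H B = Σ (Code 1) λ C → Computable (W C) ×
    (∀ x → W B x → W C x) × (∀ x → H x → ¬ W C x) × Infinite (λ x → W C x × ¬ W B x)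

  -- A c.e. set B disjoint from H that is almost contained in finitely many
  -- blocks is strongly separated from H by those blocks, one fresh block (which
  -- makes C − B infinite) and the finitely many elements of B outside the blocks.
  separate-in-blocks : ∀ {H R} → Blocks H R → (B : Code 1) → Disjoint (W B) H →
    ∀ is → W B ⊆ᵉ ⋃W R is → SeparatorOf H B
  separate-in-blocks {H} {R} blocks B B∩H=∅ is (n , B⊆U) =
    code C , computable-dom C computable-Sep , B⊆C , H∩C=∅ , C∖B-infinite
    where
    U : Pred
    U = ⋃W R is
    j : ℕ
    j = fresh is
    Sep : Pred
    Sep x = (U x ⊎ W (R j) x) ⊎ (x < n × (W B x × ¬ U x))
    computable-Sep : Computable Sep
    computable-Sep = computable-∪ (computable-∪ (computable-⋃ _ (block-computable blocks) is) (block-computable blocks j))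
                                  (computable-bounded-part (λ x → W B x × ¬ U x) n)
    C : CodeFor Sep
    C = ceCode computable-Sep
    B⊆C : ∀ x → W B x → W (code C) x
    B⊆C x x∈B with em {U x} | x <? n
    ... | yes x∈U | _ = dom⊇ C x (inj₁ (inj₁ x∈U))
    ... | no x∉U | yes x<n = dom⊇ C x (inj₂ (x<n , x∈B , x∉U))
    ... | no x∉U | no x≮n = ⊥-elim (x∉U (B⊆U x (≮⇒≥ x≮n) x∈B))
    H∩C=∅ : ∀ x → H x → ¬ W (code C) x
    H∩C=∅ x x∈H x∈C with dom⊆ C x x∈C
    ... | inj₁ (inj₁ x∈U) = ⋃-disjoint _ (block-avoids blocks) is x x∈U x∈H
    ... | inj₁ (inj₂ x∈Rj) = block-avoids blocks j x x∈Rj x∈H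
    ... | inj₂ (_ , x∈B , _) = B∩H=∅ x x∈B x∈H
    C∖B-infinite : Infinite (λ x → W (code C) x × ¬ W B x)
    C∖B-infinite m with block-infinite blocks j (m ⊔ n)
    ... | x , m⊔n≤x , x∈Rj = x , ≤-trans (m≤m⊔n m n) m⊔n≤x , dom⊇ C x (inj₁ (inj₂ x∈Rj)) , x∉B
      where
      x∉B : ¬ W B x
      x∉B x∈B = fresh-disjoint _ (blocks-disjoint blocks) is x (B⊆U x (≤-trans (m≤n⊔m m n) m⊔n≤x) x∈B) x∈Rj

  blocks⇒srs : ∀ {H R} → Blocks H R → Exhausts H (⋃W R) → StronglyRSeparable H
  blocks⇒srs blocks exhausts B B∩H=∅ =
    let is , B⊆ = exhausts B B∩H=∅ in separate-in-blocks blocks B B∩H=∅ is B⊆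

  -- Enumerate the
  -- c.e. sets V₀, V₁, … disjoint from H and build an increasing sequence of
  -- computable sets S₀ = ∅ ⊆ S₁ ⊆ … disjoint from H, where S (n+1) strongly
  -- separates Sₙ ∪ Vₙ from H; the blocks are the differences S (n+1) − Sₙ.
  module Exhaustion (H : Pred) (separate : StronglyRSeparable H) where

    Avoiding : Set
    Avoiding = Σ (Code 1) λ c → Disjoint (W c) H

    restrict : (c : Code 1) → Dec (Disjoint (W c) H) → Avoiding
    restrict c (yes c∩H=∅) = c , c∩H=∅
    restrict c (no _) = code ∅code , λ x x∈∅ _ → dom⊆ ∅code x x∈∅

    restrict-⊇ : ∀ c d → Disjoint (W c) H → ∀ x → W c x → W (proj₁ (restrict c d)) x
    restrict-⊇ c (yes _) c∩H=∅ x x∈c = x∈c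
    restrict-⊇ c (no c∩H≠∅) c∩H=∅ = ⊥-elim (c∩H≠∅ c∩H=∅)

    candidate : ℕ → Avoiding
    candidate n = restrict (enumerate n) em

    candidate-onto : ∀ V → Disjoint (W V) H → Σ ℕ λ n → ∀ x → W V x → W (proj₁ (candidate n)) x
    candidate-onto V V∩H=∅ with enumerate-onto V
    ... | n , refl = n , restrict-⊇ V em V∩H=∅

    record Stage : Set where
      field
        stage-code       : Code 1
        stage-computable : Computable (W stage-code)
        stage-avoids     : Disjoint (W stage-code) H
    open Stage

    joint : (s : Stage) (v : Avoiding) → CodeFor (W (stage-code s) ∪ W (proj₁ v))
    joint s v = ce-∪ (domain-code (stage-code s)) (domain-code (proj₁ v))

    joint-avoids : ∀ s v → Disjoint (W (code (joint s v))) H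
    joint-avoids s v x x∈joint x∈H with dom⊆ (joint s v) x x∈joint
    ... | inj₁ x∈S = stage-avoids s x x∈S x∈H
    ... | inj₂ x∈V = proj₂ v x x∈V x∈H

    next : Stage → Avoiding → Stage
    next s v with separate (code (joint s v)) (joint-avoids s v)
    ... | C , computable-C , _ , H∩C=∅ , _ =
      record { stage-code = C ; stage-computable = computable-C ; stage-avoids = λ x x∈C x∈H → H∩C=∅ x x∈H x∈C }

    next-⊇ : ∀ s v x → (W (stage-code s) ∪ W (proj₁ v)) x → W (stage-code (next s v)) x
    next-⊇ s v x x∈joint with separate (code (joint s v)) (joint-avoids s v)
    ... | _ , _ , joint⊆C , _ , _ = joint⊆C x (dom⊇ (joint s v) x x∈joint)

    next-new : ∀ s v → Infinite (λ x → W (stage-code (next s v)) x × ¬ W (stage-code s) x)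
    next-new s v m with separate (code (joint s v)) (joint-avoids s v)
    ... | _ , _ , _ , _ , C∖joint-infinite with C∖joint-infinite m
    ... | x , m≤x , x∈C , x∉joint = x , m≤x , x∈C , λ x∈S → x∉joint (dom⊇ (joint s v) x (inj₁ x∈S))

    stage : ℕ → Stage
    stage zero = record { stage-code = code ∅code
                        ; stage-computable = computable-dom ∅code computable-∅
                        ; stage-avoids = λ x x∈∅ _ → dom⊆ ∅code x x∈∅ }
    stage (suc n) = next (stage n) (candidate n)

    S : ℕ → Pred
    S n = W (stage-code (stage n))

    S-step : ∀ n x → S n x → S (suc n) x
    S-step n x x∈Sn = next-⊇ (stage n) (candidate n) x (inj₁ x∈Sn)

    S-mono : ∀ {i j} → i ≤ j → ∀ x → S i x → S j x
    S-mono {i} {j} i≤j x x∈Si with m≤n⇒m<n∨m≡n i≤j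
    ... | inj₂ refl = x∈Si
    ... | inj₁ i<j with j | i<j
    ... | suc j' | s≤s i≤j' = S-step j' x (S-mono i≤j' x x∈Si)

    candidate-in-S : ∀ n x → W (proj₁ (candidate n)) x → S (suc n) x
    candidate-in-S n x x∈V = next-⊇ (stage n) (candidate n) x (inj₂ x∈V)

    Block : ℕ → Pred
    Block n x = S (suc n) x × ¬ S n x

    computable-Block : ∀ n → Computable (Block n)
    computable-Block n = computable-∩ (stage-computable (stage (suc n))) (computable-¬ (stage-computable (stage n)))

    R : ℕ → Code 1
    R n = code (ceCode (computable-Block n))

    R⊆Block : ∀ n x → W (R n) x → Block n x
    R⊆Block n = dom⊆ (ceCode (computable-Block n))

    Block⊆R : ∀ n x → Block n x → W (R n) x
    Block⊆R n = dom⊇ (ceCode (computable-Block n))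

    blocks : Blocks H R
    blocks = record
      { block-computable = λ n → computable-dom (ceCode (computable-Block n)) (computable-Block n)
      ; block-infinite = λ n m → let x , m≤x , new = next-new (stage n) (candidate n) m in x , m≤x , Block⊆R n x new
      ; blocks-disjoint = disjoint
      ; block-avoids = λ n x x∈Rn → stage-avoids (stage (suc n)) x (proj₁ (R⊆Block n x x∈Rn)) }
      where
      disjoint : PairwiseDisjoint (λ n → W (R n))
      disjoint i j i≢j x x∈Ri x∈Rj with <-cmp i j
      ... | tri≈ _ i≡j _ = i≢j i≡j
      ... | tri< i<j _ _ = proj₂ (R⊆Block j x x∈Rj) (S-mono i<j x (proj₁ (R⊆Block i x x∈Ri)))
      ... | tri> _ _ j<i = proj₂ (R⊆Block i x x∈Ri) (S-mono j<i x (proj₁ (R⊆Block j x x∈Rj)))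

    S⊆blocks : ∀ n x → S n x → ⋃W R (List.downFrom n) x
    S⊆blocks zero x x∈S₀ = ⊥-elim (dom⊆ ∅code x x∈S₀)
    S⊆blocks (suc n) x x∈S with em {S n x}
    ... | yes x∈Sn = there (S⊆blocks n x x∈Sn)
    ... | no x∉Sn = here (Block⊆R n x (x∈S , x∉Sn))

    exhausts : Exhausts H (⋃W R)
    exhausts V V∩H=∅ with candidate-onto V V∩H=∅
    ... | n , V⊆Vn = List.downFrom (suc n) , ⊆⇒⊆ᵉ (λ x x∈V → S⊆blocks (suc n) x (candidate-in-S n x (V⊆Vn x x∈V)))

  srs⇒blocks : ∀ {H} → StronglyRSeparable H → Σ (ℕ → Code 1) λ R → Blocks H R × Exhausts H (⋃W R)
  srs⇒blocks {H} separate = R , blocks , exhausts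
    where open Exhaustion H separate

  -- Part (i), lower types: a strongly r-separable H has no generating collection
  -- consisting of one set P inside a c.e. set V disjoint from H, since a strong
  -- separator C of V from H would be almost contained in P ⊆ V although C − V
  -- is infinite.
  srs-no-single-generator : ∀ {H} → StronglyRSeparable H → (P : Pred) (V : Code 1) →
    (∀ x → P x → W V x) → Disjoint (W V) H → ¬ Generates H {⊤} (λ _ → P)
  srs-no-single-generator separate P V P⊆V V∩H=∅ (_ , covers) with separate V V∩H=∅
  ... | C , _ , _ , H∩C=∅ , C∖V-infinite with covers C (λ x x∈C x∈H → H∩C=∅ x x∈H x∈C)
  ... | is , C⊆*P with ⊆*⇒⊆ᵉ C⊆*P
  ... | n , C⊆P = infinite-⊈ᵉ∅ C∖V-infinite
    (n , λ x n≤x (x∈C , x∉V) → x∉V (P⊆V x (⋃-const {P} is x (C⊆P x n≤x x∈C))))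

  srs⇒not-type1 : ∀ {H} → StronglyRSeparable H → ¬ HasType1 H
  srs⇒not-type1 separate = srs-no-single-generator separate ∅ (code ∅code) (λ x ()) (λ x x∈∅ _ → dom⊆ ∅code x x∈∅)

  srs⇒not-type2 : ∀ {H} → StronglyRSeparable H → ¬ HasType2 H
  srs⇒not-type2 separate (R , _ , _ , generates) =
    srs-no-single-generator separate (W R) R (λ x x∈R → x∈R) (proj₁ generates tt) generates

  srs⇒not-type3 : ∀ {H} → StronglyRSeparable H → ¬ HasType3 H
  srs⇒not-type3 separate (V , _ , _ , generates) =
    srs-no-single-generator separate (W V) V (λ x x∈V → x∈V) (proj₁ generates tt) generates

  transfer-alternative : ∀ {A H} (V D D' : Code 1) → (A ∪ W D) ⊆ᵉ (H ∪ W D') →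
    (W V ⊆* (A ∪ W D)) ⊎ Cofinite (W V ∪ (A ∪ W D)) →
    (W V ⊆* (H ∪ W D')) ⊎ Cofinite (W V ∪ (H ∪ W D'))
  transfer-alternative V D D' (n , AD⊆HD') (inj₁ V⊆AD) = inj₁ (⊆ᵉ⇒⊆* (⊆ᵉ-trans (⊆*⇒⊆ᵉ V⊆AD) (n , AD⊆HD')))
  transfer-alternative {A} {H} V D D' (n , AD⊆HD') (inj₂ cofinite) = inj₂ (cofinite-⊆ᵉ cofinite (n , widen))
    where
    widen : ∀ x → n ≤ x → (W V ∪ (A ∪ W D)) x → (W V ∪ (H ∪ W D')) x
    widen x n≤x (inj₁ x∈V) = inj₁ x∈V
    widen x n≤x (inj₂ x∈AD) = inj₂ (AD⊆HD' x n≤x x∈AD)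

  module FromType5 {A : Pred} (t : Type5Data A) where
    open Type5Data t

    H : Pred
    H = A ∪ W D₀

    -- A is not computable: otherwise its complement would be a c.e. set
    -- disjoint from A, hence almost inside D₀ and finitely many blocks,
    -- but it contains every fresh block.
    no-ce-complement : CodeFor (λ x → ¬ A x) → ⊥
    no-ce-complement complement with exhausts (code complement) (λ x x∈Aᶜ x∈A → dom⊆ complement x x∈Aᶜ x∈A)
    ... | is , n , Aᶜ⊆ = infinite-⊈ᵉ∅ (block-infinite blocks j) (n , fresh-block-finite)
      where
      j : ℕ
      j = fresh is
      fresh-block-finite : ∀ x → n ≤ x → W (R j) x → ⊥
      fresh-block-finite x n≤x x∈Rj with Aᶜ⊆ x n≤x (dom⊇ complement x (λ x∈A → block-avoids blocks j x x∈Rj (inj₁ x∈A)))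
      ... | inj₁ x∈D₀ = block-avoids blocks j x x∈Rj (inj₂ x∈D₀)
      ... | inj₂ x∈⋃ = fresh-disjoint _ (blocks-disjoint blocks) is x x∈⋃ x∈Rj

    noncomputable : ¬ Computable A
    noncomputable computable-A = no-ce-complement (ceCode (computable-¬ computable-A))

    -- A ∪ D₀ is D-maximal: a c.e. D disjoint from A lies almost inside
    -- D₀ ∪ D', where D' is a finite (computable) union of blocks.
    dmax : DMaximal A → DMaximal H
    dmax (_ , alternative) = coinfinite , alternative'
      where
      coinfinite : Coinfinite H
      coinfinite n with block-infinite blocks 0 n
      ... | x , n≤x , x∈R₀ = x , n≤x , block-avoids blocks 0 x x∈R₀
      alternative' : ∀ (V : Code 1) → Σ (Code 1) λ D' → Disjoint (W D') H ×
        ((W V ⊆* (H ∪ W D')) ⊎ Cofinite (W V ∪ (H ∪ W D')))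
      alternative' V with alternative V
      ... | D , D∩A=∅ , alt with exhausts D D∩A=∅
      ... | is , n , D⊆ = code D' , D'∩H=∅ , transfer-alternative V D (code D') (n , AD⊆HD') alt
        where
        D' : CodeFor (⋃W R is)
        D' = ceCode (computable-⋃ _ (block-computable blocks) is)
        D'∩H=∅ : Disjoint (W (code D')) H
        D'∩H=∅ x x∈D' = ⋃-disjoint _ (block-avoids blocks) is x (dom⊆ D' x x∈D')
        AD⊆HD' : ∀ x → n ≤ x → (A ∪ W D) x → (H ∪ W (code D')) x
        AD⊆HD' x n≤x (inj₁ x∈A) = inj₁ (inj₁ x∈A)
        AD⊆HD' x n≤x (inj₂ x∈D) with D⊆ x n≤x x∈D
        ... | inj₁ x∈D₀ = inj₁ (inj₂ x∈D₀)
        ... | inj₂ x∈⋃ = inj₂ (dom⊇ D' x x∈⋃)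

    srs : StronglyRSeparable H
    srs = blocks⇒srs blocks exhausts-H
      where
      exhausts-H : Exhausts H (⋃W R)
      exhausts-H V V∩H=∅ with exhausts V (λ x x∈V x∈A → V∩H=∅ x x∈V (inj₁ x∈A))
      ... | is , n , V⊆ = is , n , λ x n≤x x∈V → outside-D₀ x x∈V (V⊆ x n≤x x∈V)
        where
        outside-D₀ : ∀ x → W V x → (W D₀ ∪ ⋃W R is) x → ⋃W R is x
        outside-D₀ x x∈V (inj₁ x∈D₀) = ⊥-elim (V∩H=∅ x x∈V (inj₂ x∈D₀))
        outside-D₀ x x∈V (inj₂ x∈⋃) = x∈⋃

    hemi : DMaximal A → HemiHerrmann A
    hemi dmax-A = noncomputable , D₀ , D₀-noncomputable , D₀-avoids , dmax dmax-A , srs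

  -- A D-maximal A ∪ B, with B c.e. and disjoint from A, makes A D-maximal:
  -- a c.e. D disjoint from A ∪ B becomes B ∪ D, disjoint from A.
  dmax-restrict : ∀ {A} (B : Code 1) → Disjoint (W B) A → DMaximal (A ∪ W B) → DMaximal A
  dmax-restrict {A} B B∩A=∅ (coinfinite , alternative) = coinfinite-A , alternative-A
    where
    coinfinite-A : Coinfinite A
    coinfinite-A n with coinfinite n
    ... | x , n≤x , x∉AB = x , n≤x , λ x∈A → x∉AB (inj₁ x∈A)
    alternative-A : ∀ (V : Code 1) → Σ (Code 1) λ D' → Disjoint (W D') A ×
      ((W V ⊆* (A ∪ W D')) ⊎ Cofinite (W V ∪ (A ∪ W D')))
    alternative-A V with alternative V
    ... | D , D∩AB=∅ , alt = code D' , D'∩A=∅ , transfer-alternative V D (code D') (⊆⇒⊆ᵉ regroup) alt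
      where
      D' : CodeFor (W B ∪ W D)
      D' = ce-∪ (domain-code B) (domain-code D)
      D'∩A=∅ : Disjoint (W (code D')) A
      D'∩A=∅ x x∈D' x∈A with dom⊆ D' x x∈D'
      ... | inj₁ x∈B = B∩A=∅ x x∈B x∈A
      ... | inj₂ x∈D = D∩AB=∅ x x∈D (inj₁ x∈A)
      regroup : ∀ x → ((A ∪ W B) ∪ W D) x → (A ∪ W (code D')) x
      regroup x (inj₁ (inj₁ x∈A)) = inj₁ x∈A
      regroup x (inj₁ (inj₂ x∈B)) = inj₂ (dom⊇ D' x (inj₁ x∈B))
      regroup x (inj₂ x∈D) = inj₂ (dom⊇ D' x (inj₂ x∈D))

  module FromHemi (a B : Code 1) (A-noncomputable : ¬ Computable (W a)) (B-noncomputable : ¬ Computable (W B))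
                  (B∩A=∅ : Disjoint (W B) (W a)) (herrmann : Herrmann (W a ∪ W B)) where

    A H : Pred
    A = W a
    H = A ∪ W B

    blocks-of-H : Σ (ℕ → Code 1) λ R → Blocks H R × Exhausts H (⋃W R)
    blocks-of-H = srs⇒blocks (proj₂ herrmann)

    R : ℕ → Code 1
    R = proj₁ blocks-of-H

    blocks : Blocks H R
    blocks = proj₁ (proj₂ blocks-of-H)

    exhausts-H : Exhausts H (⋃W R)
    exhausts-H = proj₂ (proj₂ blocks-of-H)

    -- For V disjoint from A, D-maximality of H can only take its first
    -- alternative: the second would make V ∪ B ∪ D a c.e. set disjoint from A
    -- covering almost the complement of A, so A would be computable.
    absorb : ∀ (V : Code 1) → Disjoint (W V) A → Σ (Code 1) λ D → Disjoint (W D) H × W V ⊆ᵉ (H ∪ W D)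
    absorb V V∩A=∅ with proj₂ (proj₁ herrmann) V
    ... | D , D∩H=∅ , inj₁ V⊆HD = D , D∩H=∅ , ⊆*⇒⊆ᵉ V⊆HD
    ... | D , D∩H=∅ , inj₂ cofinite = ⊥-elim (A-noncomputable
          (cofinitely-complemented-computable a Q A∩Q=∅ (cofinite-⊆ᵉ cofinite (⊆⇒⊆ᵉ regroup))))
      where
      Q : CodeFor (W V ∪ (W B ∪ W D))
      Q = ce-∪ (domain-code V) (ce-∪ (domain-code B) (domain-code D))
      A∩Q=∅ : Disjoint A (W V ∪ (W B ∪ W D))
      A∩Q=∅ x x∈A (inj₁ x∈V) = V∩A=∅ x x∈V x∈A
      A∩Q=∅ x x∈A (inj₂ (inj₁ x∈B)) = B∩A=∅ x x∈B x∈A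
      A∩Q=∅ x x∈A (inj₂ (inj₂ x∈D)) = D∩H=∅ x x∈D (inj₁ x∈A)
      regroup : ∀ x → (W V ∪ (H ∪ W D)) x → (A ∪ (W V ∪ (W B ∪ W D))) x
      regroup x (inj₁ x∈V) = inj₂ (inj₁ x∈V)
      regroup x (inj₂ (inj₁ (inj₁ x∈A))) = inj₁ x∈A
      regroup x (inj₂ (inj₁ (inj₂ x∈B))) = inj₂ (inj₂ (inj₁ x∈B))
      regroup x (inj₂ (inj₂ x∈D)) = inj₂ (inj₂ (inj₂ x∈D))

    exhausts-A : Exhausts A (λ is → W B ∪ ⋃W R is)
    exhausts-A V V∩A=∅ with absorb V V∩A=∅
    ... | D , D∩H=∅ , V⊆HD with exhausts-H D D∩H=∅
    ... | is , D⊆⋃ = is , ⊆ᵉ-refine (⊆ᵉ-trans V⊆HD (⊆ᵉ-∪ D⊆⋃)) drop-A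
      where
      drop-A : ∀ x → W V x → (H ∪ ⋃W R is) x → (W B ∪ ⋃W R is) x
      drop-A x x∈V (inj₁ (inj₁ x∈A)) = ⊥-elim (V∩A=∅ x x∈V x∈A)
      drop-A x x∈V (inj₁ (inj₂ x∈B)) = inj₁ x∈B
      drop-A x x∈V (inj₂ x∈⋃) = inj₂ x∈⋃

    type5-data : Type5Data A
    type5-data = record
      { D₀ = B ; R = R ; blocks = blocks
      ; D₀-infinite = noncomputable⇒infinite (W B) B-noncomputable
      ; D₀-noncomputable = B-noncomputable
      ; D₀-avoids = B∩A=∅
      ; exhausts = exhausts-A }

    -- B is not almost contained in a computable set K disjoint from A: D-maximality
    -- puts K almost inside H ∪ D, so D together with the complement of K above
    -- the bound would be a c.e. set complementing B almost everywhere.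
    no-computable-cover : (K : Code 1) → Computable (W K) → Disjoint (W K) A → ¬ (W B ⊆ᵉ W K)
    no-computable-cover K computable-K K∩A=∅ (n , B⊆K) with absorb K K∩A=∅
    ... | D , D∩H=∅ , (m , K⊆HD) =
      B-noncomputable (cofinitely-complemented-computable B Q B∩Q=∅ (m ⊔ n , covered))
      where
      Outside : Pred
      Outside x = ¬ W K x × ¬ x < n
      Q : CodeFor (W D ∪ Outside)
      Q = ce-∪ (domain-code D) (ceCode (computable-∩ (computable-¬ computable-K) (computable-¬ (computable-below n))))
      B∩Q=∅ : Disjoint (W B) (W D ∪ Outside)
      B∩Q=∅ x x∈B (inj₁ x∈D) = D∩H=∅ x x∈D (inj₂ x∈B)
      B∩Q=∅ x x∈B (inj₂ (x∉K , x≮n)) = x∉K (B⊆K x (≮⇒≥ x≮n) x∈B)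
      covered : ∀ x → m ⊔ n ≤ x → (W B ∪ (W D ∪ Outside)) x
      covered x le with em {W K x}
      ... | no x∉K = inj₂ (inj₂ (x∉K , λ x<n → <⇒≱ x<n (≤-trans (m≤n⊔m m n) le)))
      ... | yes x∈K with K⊆HD x (≤-trans (m≤m⊔n m n) le) x∈K
      ... | inj₁ (inj₁ x∈A) = ⊥-elim (K∩A=∅ x x∈K x∈A)
      ... | inj₁ (inj₂ x∈B) = inj₁ x∈B
      ... | inj₂ x∈D = inj₂ (inj₁ x∈D)

    not-type1 : ¬ HasType1 A
    not-type1 (_ , covers) with covers B B∩A=∅
    ... | is , B⊆*∅ = B-noncomputable (computable-finite
          (⊆ᵉ∅⇒finite (⊆ᵉ-refine (⊆*⇒⊆ᵉ B⊆*∅) (λ x _ x∈⋃ → ⋃-const {∅} is x x∈⋃))))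

    not-type2 : ¬ HasType2 A
    not-type2 (K , _ , computable-K , avoids , covers) with covers B B∩A=∅
    ... | is , B⊆*K = no-computable-cover K computable-K (avoids tt)
          (⊆ᵉ-refine (⊆*⇒⊆ᵉ B⊆*K) (λ x _ x∈⋃ → ⋃-const {W K} is x x∈⋃))

    -- A single generator V would almost contain a fresh block of H, which is
    -- disjoint from A, from B and from the blocks almost containing V ∖ H.
    not-type3 : ¬ HasType3 A
    not-type3 (V , _ , _ , avoids , covers) with absorb V (avoids tt)
    ... | D , D∩H=∅ , V⊆HD with exhausts-H D D∩H=∅
    ... | is , D⊆⋃ with covers (R (fresh is)) (λ x x∈Rj x∈A → block-avoids blocks (fresh is) x x∈Rj (inj₁ x∈A))
    ... | js , Rj⊆*V = infinite-⊈ᵉ∅ (block-infinite blocks (fresh is))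
          (⊆ᵉ-refine (⊆ᵉ-trans (⊆ᵉ-refine (⊆*⇒⊆ᵉ Rj⊆*V) (λ x _ x∈⋃ → ⋃-const {W V} js x x∈⋃))
                               (⊆ᵉ-trans V⊆HD (⊆ᵉ-∪ D⊆⋃)))
                     excluded)
      where
      excluded : ∀ x → W (R (fresh is)) x → (H ∪ ⋃W R is) x → ⊥
      excluded x x∈Rj (inj₁ x∈H) = block-avoids blocks (fresh is) x x∈Rj x∈H
      excluded x x∈Rj (inj₂ x∈⋃) = fresh-disjoint _ (blocks-disjoint blocks) is x x∈⋃ x∈Rj

    not-type4 : ¬ HasType4 A
    not-type4 type4 with type4-elim type4
    ... | R' , blocks' , exhausts' with exhausts' B B∩A=∅
    ... | is , B⊆⋃ = no-computable-cover (code K) (computable-dom K computable-⋃R') K∩A=∅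
          (⊆ᵉ-trans B⊆⋃ (⊆⇒⊆ᵉ (dom⊇ K)))
      where
      computable-⋃R' : Computable (⋃W R' is)
      computable-⋃R' = computable-⋃ _ (block-computable blocks') is
      K : CodeFor (⋃W R' is)
      K = ceCode computable-⋃R'
      K∩A=∅ : Disjoint (W (code K)) A
      K∩A=∅ x x∈K = ⋃-disjoint _ (block-avoids blocks') is x (dom⊆ K x x∈K)

  part-i : ∀ {A : Pred} → (DMaximal A × IsType4 A) ⇔ Herrmann A
  part-i = mk⇔
    (λ { (dmax , type4 , _) → dmax , let R , blocks , exhausts = type4-elim type4 in blocks⇒srs blocks exhausts })
    (λ { (dmax , separate) →
         dmax , (let R , blocks , exhausts = srs⇒blocks separate in type4-intro R blocks exhausts) ,
         srs⇒not-type1 separate , srs⇒not-type2 separate , srs⇒not-type3 separate })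

  part-ii : ∀ (a : Code 1) → (DMaximal (W a) × IsType5 (W a)) ⇔ HemiHerrmann (W a)
  part-ii a = mk⇔
    (λ { (dmax , type5 , _) → FromType5.hemi (type5-elim type5) dmax })
    (λ { (A-noncomputable , B , B-noncomputable , B∩A=∅ , herrmann) →
         let open FromHemi a B A-noncomputable B-noncomputable B∩A=∅ herrmann in
         dmax-restrict B B∩A=∅ (proj₁ herrmann) , type5-intro type5-data ,
         not-type1 , not-type2 , not-type3 , not-type4 })

lemma4p3 : ExcludedMiddle 0ℓ → (A : Code 1) →
    ((DMaximal (W A) × IsType4 (W A)) ⇔ Herrmann (W A)) ×
    ((DMaximal (W A) × IsType5 (W A)) ⇔ HemiHerrmann (W A))
lemma4p3 em A = Classical.part-i em , Classical.part-ii em A
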